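{- Let $n\ge1$ and $x,y$ coprime with $1\le x<y$, consider the rotor multigraph $P^{x,y}_n$, let $F=\sum_{i=0}^n x^{n-i}y^i$, and let $\bar h:\Sigma\to\mathbb{Z}/F\mathbb{Z}$ and $\bar g:\mathcal{R}\to\mathbb{Z}/F\mathbb{Z}$ be $h$ and $g$ reduced modulo $F$. Then: (i) the Sandpile Group $SP(P^{x,y}_n)$ is cyclic of order $F$; (ii) $\bar h$ induces a well-defined map on $\Sigma/\!\sim_S$ which is a group isomorphism between $SP(P^{x,y}_n)$ and $\mathbb{Z}/F\mathbb{Z}$; (iii) $\bar g$ induces a well-defined map on rotor equivalence classes $\mathcal{R}/\!\sim$ which is a bijection onto $\mathbb{Z}/F\mathbb{Z}$; (iv) for every rotor-particle configuration $(\rho,\sigma)$ and every $(\rho',\sigma')\in\mathrm{routing}^\infty(\rho,\sigma)$, we have $\bar g(\rho')=\bar g(\rho)-\bar h(\sigma)$.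
   Context: The path multigraph $P^{x,y}_n$ has vertices $u_0,\dots,u_{n+1}$; $u_0,u_{n+1}$ are sinks and $V_0=\{u_1,\dots,u_n\}$. For $k\in\{1,\dots,n\}$, $u_k$ has outgoing arcs $a^k_0,\dots,a^k_{x+y-1}$, where $a^k_i$ goes to $u_{k+1}$ for $0\le i\le x-1$ and to $u_{k-1}$ for $x\le i\le x+y-1$; the rotor order is $\theta(a^k_i)=a^k_{(i+1)\bmod (x+y)}$. A rotor configuration assigns to each $u\in V_0$ an outgoing arc $\rho(u)$; $\mathcal{R}$ is their set. Particle configurations are maps $\sigma:\{u_0,\dots,u_{n+1}\}\to\mathbb{Z}$, forming the group $\Sigma$; a vertex $u$ is identified with the configuration with one particle on $u$. For $u\in V_0$, $\mathrm{routing}^+_u(\rho,\sigma)=(\rho',\sigma+\mathrm{head}(\rho(u))-u)$ with $\rho'$ equal to $\rho$ except $\rho'(u)=\theta(\rho(u))$; these are commuting bijections; for $r:V_0\to\mathbb{Z}$, $\mathrm{routing}^r$ composes the $(\mathrm{routing}^+_u)^{r(u)}$ (negative powers = inverse). $(\rho,\sigma)\sim(\rho',\sigma')$ iff $\mathrm{routing}^r(\rho,\sigma)=(\rho',\sigma')$ for some $r$. Rotor configurations: $\rho\sim\rho'$ iff $(\rho,\sigma)\sim(\rho',\sigma)$ for some $\sigma\in\Sigma$. Particle configurations: $\sigma\sim\sigma'$ iff $(\rho,\sigma)\sim(\rho,\sigma')$ for some $\rho\in\mathcal{R}$; and $\sigma\sim_S\sigma'$ iff there is $\sigma_1\sim\sigma$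 with $\sigma_1(u)=\sigma'(u)$ for all $u\in V_0$. The Sandpile Group $SP(P^{x,y}_n)$ is the quotient $\Sigma/\!\sim_S$ with the addition inherited from $\Sigma$. $\mathrm{routing}^\infty(\rho,\sigma)$ is the set of $(\rho',\sigma')\sim(\rho,\sigma)$ with $\sigma'(u)=0$ for all $u\in V_0$. The function $h:\Sigma\to\mathbb{Z}$ is linear with $h(u_0)=0$ and $h(u_k)=\sum_{i=0}^{k-1}x^{n-i}y^i$ for $1\le k\le n+1$. The function $g$ is defined on arcs by $g(a^k_j)=\sum_{i=0}^{j-1}\big(h(\mathrm{head}(a^k_i))-h(u_k)\big)$ (so $g(a^k_0)=0$), and $g(\rho)=\sum_{u\in V_0}g(\rho(u))$. -}

module Defs where

open import Data.Nat as ℕ using (ℕ; zero; suc; _∸_; _^_; _<?_)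
open import Data.Nat.DivMod using (_%_; m%n<n)
open import Data.Fin using (Fin; zero; suc; toℕ; fromℕ<; inject₁; _≟_)
open import Data.Integer using (ℤ; +_; 0ℤ; 1ℤ; _+_; _-_; _*_; -[1+_])
open import Data.Integer.Divisibility using (_∣_)
open import Data.List using (List; foldr; allFin)
open import Data.Product using (_×_; _,_; proj₁; proj₂; ∃)
open import Relation.Binary.PropositionalEquality using (_≡_)
open import Relation.Nullary.Decidable using (does)
open import Data.Bool using (if_then_else_)
open import Function using (_∘_)

_≋_[mod_] : ℤ → ℤ → ℕ → Set
a ≋ b [mod m ] = (+ m) ∣ (a - b)

ΣFin : ∀ {m} → (Fin m → ℤ) → ℤ
ΣFin {zero} f = 0ℤ
ΣFin {suc m} f = f zero + ΣFin (f ∘ suc)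

Σ< : ℕ → (ℕ → ℕ) → ℕ
Σ< zero f = 0
Σ< (suc k) f = Σ< k f ℕ.+ f k

θ : ∀ {m} → Fin m → Fin m
θ {suc m} i = fromℕ< (m%n<n (suc (toℕ i)) (suc m))

θ⁻¹ : ∀ {m} → Fin m → Fin m
θ⁻¹ {suc m} i = fromℕ< (m%n<n (toℕ i ℕ.+ m) (suc m))

-- Vertices u_0,…,u_{n+1} are Fin (2+n) (u_k ↔ k).
-- Non-sink vertices V_0 = {u_1,…,u_n} are indexed by Fin n (i ↔ u_{i+1}).
-- Arcs out of a non-sink vertex are indexed by Fin (x+y) (j ↔ a^k_j).
module Path (n x y : ℕ) where

  Vertex : Set
  Vertex = Fin (suc (suc n))

  V₀ : Set
  V₀ = Fin n

  Arc : Set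
  Arc = Fin (x ℕ.+ y)

  inner : V₀ → Vertex
  inner i = suc (inject₁ i)

  headℕ : V₀ → ℕ → Vertex
  headℕ i j = if does (j <? x) then suc (suc i) else inject₁ (inject₁ i)

  head : V₀ → Arc → Vertex
  head i a = headℕ i (toℕ a)

  Rotor : Set
  Rotor = V₀ → Arc

  Particle : Set
  Particle = Vertex → ℤ

  δ : Vertex → Particle
  δ v w = if does (v ≟ w) then 1ℤ else 0ℤ

  0P : Particle
  0P _ = 0ℤ

  _+P_ : Particle → Particle → Particle
  (σ +P τ) v = σ v + τ v

  _·P_ : ℤ → Particle → Particle
  (k ·P σ) v = k * σ v

  Config : Set
  Config = Rotor × Particle

  _≈C_ : Config → Config → Set
  (ρ , σ) ≈C (ρ' , σ') = (∀ u → ρ u ≡ ρ' u) × (∀ v → σ v ≡ σ' v)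

  routing⁺ : V₀ → Config → Config
  routing⁺ u (ρ , σ) =
    (λ w → if does (w ≟ u) then θ (ρ u) else ρ w) ,
    (λ w → σ w + δ (head u (ρ u)) w - δ (inner u) w)

  routing⁻ : V₀ → Config → Config
  routing⁻ u (ρ , σ) =
    (λ w → if does (w ≟ u) then a else ρ w) ,
    (λ w → σ w - δ (head u a) w + δ (inner u) w)
    where
    a : Arc
    a = θ⁻¹ (ρ u)

  iter : (Config → Config) → ℕ → Config → Config
  iter f zero c = c
  iter f (suc k) c = f (iter f k c)

  routingPow : V₀ → ℤ → Config → Config
  routingPow u (+ k) = iter (routing⁺ u) k
  routingPow u -[1+ k ] = iter (routing⁻ u) (suc k)

  routing : (V₀ → ℤ) → Config → Config
  routing r c = foldr (λ u c' → routingPow u (r u) c') c (allFin n)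

  _~_ : Config → Config → Set
  c ~ c' = ∃ λ (r : V₀ → ℤ) → routing r c ≈C c'

  _~R_ : Rotor → Rotor → Set
  ρ ~R ρ' = ∃ λ (σ : Particle) → (ρ , σ) ~ (ρ' , σ)

  _~P_ : Particle → Particle → Set
  σ ~P σ' = ∃ λ (ρ : Rotor) → (ρ , σ) ~ (ρ , σ')

  _~S_ : Particle → Particle → Set
  σ ~S σ' = ∃ λ (σ₁ : Particle) → (σ₁ ~P σ) × (∀ (u : V₀) → σ₁ (inner u) ≡ σ' (inner u))

  _∈routing∞_ : Config → Config → Set
  (ρ' , σ') ∈routing∞ c = (c ~ (ρ' , σ')) × (∀ (u : V₀) → σ' (inner u) ≡ 0ℤ)

  hVertex : Vertex → ℤ
  hVertex v = + Σ< (toℕ v) (λ i → x ^ (n ∸ i) ℕ.* y ^ i)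

  h : Particle → ℤ
  h σ = ΣFin (λ v → σ v * hVertex v)

  F : ℕ
  F = Σ< (suc n) (λ i → x ^ (n ∸ i) ℕ.* y ^ i)

  gArcℕ : V₀ → ℕ → ℤ
  gArcℕ i zero = 0ℤ
  gArcℕ i (suc j) = gArcℕ i j + (hVertex (headℕ i j) - hVertex (inner i))

  gArc : V₀ → Arc → ℤ
  gArc i a = gArcℕ i (toℕ a)

  g : Rotor → ℤ
  g ρ = ΣFin (λ u → gArc u (ρ u))

-- The rotor function g is built so that g ρ - h σ is invariant under every routing step: advancing
-- the rotor at u_k raises g by exactly the height gained by the particle it moves, and a full turn
-- is neutral because x · weight (k + 1) = y · weight k.  This gives (iv) and the easy halves of
-- (ii) and (iii).  For the converses, let u_k make M k full turns (M 0 = M (n + 1) = 0): the net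
-- flow across the edge u_e u_{e+1} is x M e - y M (e + 1) up to terms read off the initial and final
-- rotors, so prescribing the flows amounts to the chain equations x M e - y M (e + 1) = t e, which
-- have an integral solution exactly when Σ weight e · t e = 0, by coprimality of x and y.  For
-- particles this condition is h σ ≡ h σ' modulo F; for rotors it leaves a constant slack flow,
-- which monotonicity of the rotor counts forces to be zero.  Finally h takes the value 1 on a
-- Bézout combination of u_1 and u_{n+1}, and g reaches every residue because each chip dropped on
-- u_n changes g by y ^ n, a unit modulo F.

module Submission where

open import Defs
open import Data.Nat using (ℕ; _≤_; _<_)
open import Data.Nat.Coprimality using (Coprime)
open import Data.Integer using (ℤ; _+_; _-_; +_)
open import Data.Integer.Divisibility using (_∣_)
open import Data.Product using (_×_; _,_; ∃; Σ-syntax)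
open import Function.Bundles using (_⇔_)
open import Relation.Binary.PropositionalEquality using (_≡_)

open import Data.Bool using (if_then_else_)
open import Data.Empty using (⊥-elim)
open import Data.Fin using (Fin; zero; suc; toℕ; fromℕ<; inject₁; fromℕ; _≟_)
import Data.Fin.Properties as Finₚ
open import Data.Integer using (_*_; -_; 0ℤ; 1ℤ; -[1+_])
import Data.Integer as ℤ
import Data.Integer.Coprimality as ℤ
import Data.Integer.Divisibility.Signed as ℤ
import Data.Integer.DivMod as ℤ
import Data.Integer.Properties as ℤₚ
open import Data.Integer.Tactic.RingSolver using (solve-∀)
open import Data.List using (List; []; _∷_; foldr; allFin; tabulate)
open import Data.List.Membership.Propositional using (_∈_)
import Data.List.Membership.Propositional.Properties as Listₚ
open import Data.List.Relation.Unary.All using (All; []; _∷_)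
open import Data.List.Relation.Unary.AllPairs using (_∷_)
open import Data.List.Relation.Unary.Any using (here; there)
open import Data.List.Relation.Unary.Unique.Propositional using (Unique)
import Data.List.Relation.Unary.Unique.Propositional.Properties as Uniqueₚ
import Data.Nat as ℕ
open import Data.Nat using (zero; suc; s≤s; z≤n)
import Data.Nat.Coprimality as ℕ
import Data.Nat.Divisibility as ℕ
import Data.Nat.DivMod as ℕ
import Data.Nat.GCD as ℕ
import Data.Nat.Properties as ℕₚ
import Data.Nat.Tactic.RingSolver as ℕ
open import Data.Product using (proj₁; proj₂)
open import Data.Sum using (_⊎_; inj₁; inj₂)
import Data.Sum as Sum
open import Function using (_∘_)
open import Data.Nat.GeneralisedArithmetic using (fold)
open import Function.Bundles using (mk⇔)
open import Relation.Binary.PropositionalEquality using (refl; sym; trans; cong; cong₂; subst; subst₂; module ≡-Reasoning)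
open import Relation.Nullary using (yes; no; does; ¬_)
open import Relation.Nullary.Decidable using (dec-true; dec-false)

ΣFin-cong : ∀ {m} {f g : Fin m → ℤ} → (∀ u → f u ≡ g u) → ΣFin f ≡ ΣFin g
ΣFin-cong {zero} e = refl
ΣFin-cong {suc m} e = cong₂ _+_ (e zero) (ΣFin-cong (e ∘ suc))

ΣFin-+ : ∀ {m} (f g : Fin m → ℤ) → ΣFin (λ u → f u + g u) ≡ ΣFin f + ΣFin g
ΣFin-+ {zero} f g = refl
ΣFin-+ {suc m} f g = trans (cong (_+_ (f zero + g zero)) (ΣFin-+ (f ∘ suc) (g ∘ suc)))
  (ring (f zero) (g zero) (ΣFin (f ∘ suc)) (ΣFin (g ∘ suc)))
  where
  ring : ∀ a b c d → (a + b) + (c + d) ≡ (a + c) + (b + d)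
  ring = solve-∀

ΣFin-neg : ∀ {m} (f : Fin m → ℤ) → ΣFin (λ u → - f u) ≡ - ΣFin f
ΣFin-neg {zero} f = refl
ΣFin-neg {suc m} f = trans (cong (_+_ (- f zero)) (ΣFin-neg (f ∘ suc)))
  (sym (ℤₚ.neg-distrib-+ (f zero) (ΣFin (f ∘ suc))))

ΣFin-- : ∀ {m} (f g : Fin m → ℤ) → ΣFin (λ u → f u - g u) ≡ ΣFin f - ΣFin g
ΣFin-- f g = trans (ΣFin-+ f (λ u → - g u)) (cong (_+_ (ΣFin f)) (ΣFin-neg g))

ΣFin-* : ∀ {m} (c : ℤ) (f : Fin m → ℤ) → ΣFin (λ u → c * f u) ≡ c * ΣFin f
ΣFin-* {zero} c f = sym (ℤₚ.*-zeroʳ c)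
ΣFin-* {suc m} c f = trans (cong (_+_ (c * f zero)) (ΣFin-* c (f ∘ suc)))
  (sym (ℤₚ.*-distribˡ-+ c (f zero) (ΣFin (f ∘ suc))))

ΣFin-zero : ∀ {m} (f : Fin m → ℤ) → (∀ u → f u ≡ 0ℤ) → ΣFin f ≡ 0ℤ
ΣFin-zero {zero} f e = refl
ΣFin-zero {suc m} f e = cong₂ _+_ (e zero) (ΣFin-zero (f ∘ suc) (e ∘ suc))

ΣFin-init-last : ∀ m (f : Fin (suc m) → ℤ) → ΣFin f ≡ ΣFin (f ∘ inject₁) + f (fromℕ m)
ΣFin-init-last zero f = trans (ℤₚ.+-identityʳ (f zero)) (sym (ℤₚ.+-identityˡ (f zero)))
ΣFin-init-last (suc m) f = trans (cong (_+_ (f zero)) (ΣFin-init-last m (f ∘ suc)))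
  (sym (ℤₚ.+-assoc (f zero) (ΣFin (f ∘ suc ∘ inject₁)) (f (suc (fromℕ m)))))

δFin : ∀ {m} → Fin m → Fin m → ℤ
δFin v w = if does (v ≟ w) then 1ℤ else 0ℤ

ΣFin-δ : ∀ {m} (v : Fin m) (f : Fin m → ℤ) → ΣFin (λ w → δFin v w * f w) ≡ f v
ΣFin-δ {suc m} zero f = trans (cong₂ _+_ (ℤₚ.*-identityˡ (f zero))
  (ΣFin-zero (λ w → δFin zero (suc w) * f (suc w)) (λ w → ℤₚ.*-zeroˡ (f (suc w)))))
  (ℤₚ.+-identityʳ (f zero))
ΣFin-δ {suc m} (suc v) f = trans (cong (_+_ (0ℤ * f zero)) (ΣFin-δ v (f ∘ suc))) (ℤₚ.+-identityˡ (f (suc v)))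

ΣFin-update : ∀ {m} (f g : Fin m → ℤ) (u : Fin m) → (∀ w → ¬ w ≡ u → f w ≡ g w) →
              ΣFin f ≡ ΣFin g + (f u - g u)
ΣFin-update f g u agree = begin
  ΣFin f                                        ≡⟨ ΣFin-cong pointwise ⟩
  ΣFin (λ w → g w + δFin u w * (f u - g u))     ≡⟨ ΣFin-+ g _ ⟩
  ΣFin g + ΣFin (λ w → δFin u w * (f u - g u))  ≡⟨ cong (_+_ (ΣFin g)) (ΣFin-δ u (λ _ → f u - g u)) ⟩
  ΣFin g + (f u - g u)                          ∎
  where
  open ≡-Reasoning
  pointwise : ∀ w → f w ≡ g w + δFin u w * (f u - g u)
  pointwise w with u ≟ w
  ... | yes refl = ring (f u) (g u)
    where
    ring : ∀ a b → a ≡ b + 1ℤ * (a - b)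
    ring = solve-∀
  ... | no u≢w = trans (agree w (u≢w ∘ sym)) (ring (g w) (f u - g u))
    where
    ring : ∀ a b → a ≡ a + 0ℤ * b
    ring = solve-∀

Σℤ : ℕ → (ℕ → ℤ) → ℤ
Σℤ zero f = 0ℤ
Σℤ (suc k) f = Σℤ k f + f k

Σℤ-cong : ∀ k {f g : ℕ → ℤ} → (∀ i → i < k → f i ≡ g i) → Σℤ k f ≡ Σℤ k g
Σℤ-cong zero e = refl
Σℤ-cong (suc k) e = cong₂ _+_ (Σℤ-cong k (λ i i<k → e i (ℕₚ.m<n⇒m<1+n i<k))) (e k (ℕₚ.n<1+n k))

Σℤ-suc : ∀ k (f : ℕ → ℤ) → Σℤ (suc k) f ≡ f 0 + Σℤ k (f ∘ suc)
Σℤ-suc zero f = trans (ℤₚ.+-identityˡ (f 0)) (sym (ℤₚ.+-identityʳ (f 0)))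
Σℤ-suc (suc k) f = trans (cong (_+ f (suc k)) (Σℤ-suc k f)) (ℤₚ.+-assoc (f 0) (Σℤ k (f ∘ suc)) (f (suc k)))

Σℤ-+ : ∀ k (f g : ℕ → ℤ) → Σℤ k (λ i → f i + g i) ≡ Σℤ k f + Σℤ k g
Σℤ-+ zero f g = refl
Σℤ-+ (suc k) f g = trans (cong (_+ (f k + g k)) (Σℤ-+ k f g)) (ring (Σℤ k f) (Σℤ k g) (f k) (g k))
  where
  ring : ∀ a b c d → (a + b) + (c + d) ≡ (a + c) + (b + d)
  ring = solve-∀

Σℤ-neg : ∀ k (f : ℕ → ℤ) → Σℤ k (λ i → - f i) ≡ - Σℤ k f
Σℤ-neg zero f = refl
Σℤ-neg (suc k) f = trans (cong (_+ - f k) (Σℤ-neg k f)) (sym (ℤₚ.neg-distrib-+ (Σℤ k f) (f k)))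

Σℤ-- : ∀ k (f g : ℕ → ℤ) → Σℤ k (λ i → f i - g i) ≡ Σℤ k f - Σℤ k g
Σℤ-- k f g = trans (Σℤ-+ k f (λ i → - g i)) (cong (_+_ (Σℤ k f)) (Σℤ-neg k g))

Σℤ-* : ∀ k (c : ℤ) (f : ℕ → ℤ) → Σℤ k (λ i → c * f i) ≡ c * Σℤ k f
Σℤ-* zero c f = sym (ℤₚ.*-zeroʳ c)
Σℤ-* (suc k) c f = trans (cong (_+ c * f k) (Σℤ-* k c f)) (sym (ℤₚ.*-distribˡ-+ c (Σℤ k f) (f k)))

ΣFin-toℕ : ∀ m (f : ℕ → ℤ) → ΣFin {m} (f ∘ toℕ) ≡ Σℤ m f
ΣFin-toℕ zero f = refl
ΣFin-toℕ (suc m) f = trans (cong (_+_ (f 0)) (ΣFin-toℕ m (f ∘ suc))) (sym (Σℤ-suc m f))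

Σ<-suc : ∀ k (f : ℕ → ℕ) → Σ< (suc k) f ≡ f 0 ℕ.+ Σ< k (f ∘ suc)
Σ<-suc zero f = ℕₚ.+-comm 0 (f 0)
Σ<-suc (suc k) f = trans (cong (ℕ._+ f (suc k)) (Σ<-suc k f)) (ℕₚ.+-assoc (f 0) _ _)

∣-Σ< : ∀ {d} k (f : ℕ → ℕ) → (∀ i → i < k → d ℕ.∣ f i) → d ℕ.∣ Σ< k f
∣-Σ< {d} zero f d∣f = ℕ._∣0 d
∣-Σ< (suc k) f d∣f = ℕ.∣m∣n⇒∣m+n (∣-Σ< k f (λ i i<k → d∣f i (ℕₚ.m<n⇒m<1+n i<k))) (d∣f k (ℕₚ.n<1+n k))

δℕ : ℕ → ℕ → ℤ
δℕ a b = if does (a ℕ.≟ b) then 1ℤ else 0ℤ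

δℕ-refl : ∀ a → δℕ a a ≡ 1ℤ
δℕ-refl a = cong (if_then 1ℤ else 0ℤ) (dec-true (a ℕ.≟ a) refl)

δℕ-≢ : ∀ {a b} → ¬ a ≡ b → δℕ a b ≡ 0ℤ
δℕ-≢ {a} {b} a≢b = cong (if_then 1ℤ else 0ℤ) (dec-false (a ℕ.≟ b) a≢b)

δFin-toℕ : ∀ {m} (v w : Fin m) → δFin v w ≡ δℕ (toℕ v) (toℕ w)
δFin-toℕ v w with v ≟ w
... | yes refl = sym (δℕ-refl (toℕ v))
... | no v≢w = sym (δℕ-≢ (v≢w ∘ Finₚ.toℕ-injective))

select : ∀ (m : ℕ) (z : ℕ → ℤ) (c t : ℕ) → ℤ
select m z c t = ΣFin {m} (λ u → z (toℕ u) * δℕ (c ℕ.+ toℕ u) t)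

select-suc : ∀ m z c t → select (suc m) z c t ≡ z 0 * δℕ c t + select m (z ∘ suc) (suc c) t
select-suc m z c t = cong₂ _+_ (cong (λ k → z 0 * δℕ k t) (ℕₚ.+-identityʳ c))
  (ΣFin-cong {m} (λ u → cong (λ k → z (suc (toℕ u)) * δℕ k t) (ℕₚ.+-suc c (toℕ u))))

select-skip : ∀ m z c t → ¬ c ≡ t → select (suc m) z c t ≡ select m (z ∘ suc) (suc c) t
select-skip m z c t c≢t = begin
  select (suc m) z c t                          ≡⟨ select-suc m z c t ⟩
  z 0 * δℕ c t + select m (z ∘ suc) (suc c) t   ≡⟨ cong (λ d → z 0 * d + select m (z ∘ suc) (suc c) t) (δℕ-≢ c≢t) ⟩
  z 0 * 0ℤ + select m (z ∘ suc) (suc c) t       ≡⟨ cong (_+ select m (z ∘ suc) (suc c) t) (ℤₚ.*-zeroʳ (z 0)) ⟩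
  0ℤ + select m (z ∘ suc) (suc c) t             ≡⟨ ℤₚ.+-identityˡ _ ⟩
  select m (z ∘ suc) (suc c) t                  ∎
  where open ≡-Reasoning

select-below : ∀ m z c t → t < c → select m z c t ≡ 0ℤ
select-below zero z c t t<c = refl
select-below (suc m) z c t t<c = trans (select-skip m z c t (λ c≡t → ℕₚ.<-irrefl (sym c≡t) t<c))
  (select-below m (z ∘ suc) (suc c) t (ℕₚ.m<n⇒m<1+n t<c))

select-above : ∀ m z c t → c ℕ.+ m ≤ t → select m z c t ≡ 0ℤ
select-above zero z c t c+m≤t = refl
select-above (suc m) z c t c+m≤t =
  trans (select-skip m z c t (λ c≡t → ℕₚ.<-irrefl c≡t (ℕₚ.<-≤-trans (ℕₚ.m<m+n c (s≤s z≤n)) c+m≤t)))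
        (select-above m (z ∘ suc) (suc c) t (subst (_≤ t) (ℕₚ.+-suc c m) c+m≤t))

select-inside : ∀ m z c t → c ≤ t → t < c ℕ.+ m → select m z c t ≡ z (t ℕ.∸ c)
select-inside zero z c t c≤t t<c+m =
  ⊥-elim (ℕₚ.<-irrefl refl (ℕₚ.<-≤-trans t<c+m (subst (_≤ t) (sym (ℕₚ.+-identityʳ c)) c≤t)))
select-inside (suc m) z c t c≤t t<c+m with c ℕ.≟ t
... | yes refl = begin
  select (suc m) z c c                          ≡⟨ select-suc m z c c ⟩
  z 0 * δℕ c c + select m (z ∘ suc) (suc c) c   ≡⟨ cong₂ (λ d s → z 0 * d + s) (δℕ-refl c) (select-below m (z ∘ suc) (suc c) c (ℕₚ.n<1+n c)) ⟩
  z 0 * 1ℤ + 0ℤ                                 ≡⟨ trans (ℤₚ.+-identityʳ _) (ℤₚ.*-identityʳ (z 0)) ⟩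
  z 0                                           ≡⟨ cong z (sym (ℕₚ.n∸n≡0 c)) ⟩
  z (c ℕ.∸ c)                                   ∎
  where open ≡-Reasoning
... | no c≢t = begin
  select (suc m) z c t           ≡⟨ select-skip m z c t c≢t ⟩
  select m (z ∘ suc) (suc c) t   ≡⟨ select-inside m (z ∘ suc) (suc c) t c<t (subst (t <_) (ℕₚ.+-suc c m) t<c+m) ⟩
  z (suc (t ℕ.∸ suc c))          ≡⟨ cong z (sym (ℕₚ.+-∸-assoc 1 c<t)) ⟩
  z (t ℕ.∸ c)                    ∎
  where
  open ≡-Reasoning
  c<t : c < t
  c<t = ℕₚ.≤∧≢⇒< c≤t c≢t

ΣFin-δ-select : ∀ {m p} (c : Fin m → ℤ) (z : ℕ → ℤ) (e : Fin m → Fin p) k →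
                (∀ u → c u ≡ z (toℕ u)) → (∀ u → toℕ (e u) ≡ k ℕ.+ toℕ u) →
                ∀ w → ΣFin (λ u → c u * δFin (e u) w) ≡ select m z k (toℕ w)
ΣFin-δ-select c z e k c≗z e≗ w =
  ΣFin-cong (λ u → cong₂ _*_ (c≗z u) (trans (δFin-toℕ (e u) w) (cong (λ t → δℕ t (toℕ w)) (e≗ u))))

Σlist : ∀ {A : Set} → List A → (A → ℤ) → ℤ
Σlist [] f = 0ℤ
Σlist (a ∷ as) f = f a + Σlist as f

Σlist-tabulate : ∀ {A : Set} {m} (g : Fin m → A) (f : A → ℤ) → Σlist (tabulate g) f ≡ ΣFin (f ∘ g)
Σlist-tabulate {m = zero} g f = refl
Σlist-tabulate {m = suc m} g f = cong (_+_ (f (g zero))) (Σlist-tabulate (g ∘ suc) f)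

i-k≡j-k⇒i≡j : ∀ i j k → i - k ≡ j - k → i ≡ j
i-k≡j-k⇒i≡j i j k e = trans (ring i k) (trans (cong (_+ k) e) (sym (ring j k)))
  where
  ring : ∀ a b → a ≡ a - b + b
  ring = solve-∀

k-i≡k-j⇒i≡j : ∀ i j k → k - i ≡ k - j → i ≡ j
k-i≡k-j⇒i≡j i j k e = trans (ring k i) (trans (cong (_-_ k) e) (sym (ring k j)))
  where
  ring : ∀ a b → b ≡ a - (a - b)
  ring = solve-∀

0<i-j⇒j<i : ∀ i j → 0ℤ ℤ.< i - j → j ℤ.< i
0<i-j⇒j<i i j 0<i-j = subst₂ ℤ._<_ (ℤₚ.+-identityˡ j) (ring i j) (ℤₚ.+-monoˡ-< j 0<i-j)
  where
  ring : ∀ a b → a - b + b ≡ a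
  ring = solve-∀

pos-suc : ∀ t → + suc t ≡ + t + 1ℤ
pos-suc t = trans (cong +_ (ℕₚ.+-comm 1 t)) (ℤₚ.pos-+ t 1)

+-pos-suc : ∀ a t → a + + suc t ≡ a + + t + 1ℤ
+-pos-suc a t = trans (cong (_+_ a) (pos-suc t)) (sym (ℤₚ.+-assoc a (+ t) 1ℤ))

pos-form : ∀ a k t → + a * + k + + t ≡ + (a ℕ.* k ℕ.+ t)
pos-form a k t = trans (cong (_+ + t) (sym (ℤₚ.pos-* a k))) (sym (ℤₚ.pos-+ (a ℕ.* k) t))

-m+t≤0 : ∀ m t → t ≤ m → - + m + + t ℤ.≤ 0ℤ
-m+t≤0 m t t≤m = subst (ℤ._≤ 0ℤ) (sym eq) ℤₚ.neg-≤-pos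
  where
  eq : - + m + + t ≡ - + (m ℕ.∸ t)
  eq = trans (ℤₚ.+-comm (- + m) (+ t)) (trans (ℤₚ.m-n≡m⊖n t m) (ℤₚ.⊖-≤ t≤m))

multiple+small≡small⇒0 : ∀ {m} (d : ℤ) {b b'} → b < m → b' < m → d * + m + + b ≡ + b' → d ≡ 0ℤ
multiple+small≡small⇒0 (+ zero) _ _ _ = refl
multiple+small≡small⇒0 {m} (+ suc k) {b} {b'} _ b'<m e = ⊥-elim (ℕₚ.<⇒≱ b'<m (subst (m ≤_) e' m≤))
  where
  e' : suc k ℕ.* m ℕ.+ b ≡ b'
  e' = ℤₚ.+-injective (trans (sym (pos-form (suc k) m b)) e)
  m≤ : m ≤ suc k ℕ.* m ℕ.+ b
  m≤ = ℕₚ.≤-trans (ℕₚ.m≤m+n m (k ℕ.* m)) (ℕₚ.m≤m+n (suc k ℕ.* m) b)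
multiple+small≡small⇒0 {m} -[1+ k ] {b} {b'} b<m _ e = ⊥-elim (ℕₚ.<⇒≱ b<m (subst (m ≤_) (sym e') m≤))
  where
  e' : b ≡ b' ℕ.+ suc k ℕ.* m
  e' = ℤₚ.+-injective (begin
    + b                                      ≡⟨ ring (+ b) (+ (suc k ℕ.* m)) ⟩
    - + (suc k ℕ.* m) + + b + + (suc k ℕ.* m) ≡⟨ cong (λ t → - t + + b + + (suc k ℕ.* m)) (ℤₚ.pos-* (suc k) m) ⟩
    - (+ suc k * + m) + + b + + (suc k ℕ.* m) ≡⟨ cong (λ t → t + + b + + (suc k ℕ.* m)) (ℤₚ.neg-distribˡ-* (+ suc k) (+ m)) ⟩
    -[1+ k ] * + m + + b + + (suc k ℕ.* m)   ≡⟨ cong (_+ + (suc k ℕ.* m)) e ⟩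
    + b' + + (suc k ℕ.* m)                   ≡⟨ ℤₚ.pos-+ b' (suc k ℕ.* m) ⟨
    + (b' ℕ.+ suc k ℕ.* m)                   ∎)
    where
    open ≡-Reasoning
    ring : ∀ a b → a ≡ - b + a + b
    ring = solve-∀
  m≤ : m ≤ b' ℕ.+ suc k ℕ.* m
  m≤ = ℕₚ.≤-trans (ℕₚ.m≤m+n m (k ℕ.* m)) (ℕₚ.m≤n+m (suc k ℕ.* m) b')

quotient-remainder-unique : ∀ {m} q q' {b b'} → b < m → b' < m → q * + m + + b ≡ q' * + m + + b' → q ≡ q' × b ≡ b'
quotient-remainder-unique {m} q q' {b} {b'} b<m b'<m e = q≡q' , ℤₚ.+-injective b≡b'
  where
  q≡q' : q ≡ q'
  q≡q' = ℤₚ.i-j≡0⇒i≡j q q' (multiple+small≡small⇒0 (q - q') b<m b'<m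
           (trans (ring₁ q q' (+ m) (+ b)) (trans (cong (λ t → t - q' * + m) e) (ring₂ q' (+ m) (+ b')))))
    where
    ring₁ : ∀ q q' m b → (q - q') * m + b ≡ q * m + b - q' * m
    ring₁ = solve-∀
    ring₂ : ∀ q' m b → q' * m + b - q' * m ≡ b
    ring₂ = solve-∀
  b≡b' : + b ≡ + b'
  b≡b' = trans (sym (ring q (+ m) (+ b))) (trans (cong (λ t → t - q * + m) (trans e (cong (λ t → t * + m + + b') (sym q≡q'))))
                                                   (ring q (+ m) (+ b')))
    where
    ring : ∀ q m b → q * m + b - q * m ≡ b
    ring = solve-∀

1+n≡m⇒m-n≡1 : ∀ {m n} → 1 ℕ.+ n ≡ m → + m - + n ≡ 1ℤ
1+n≡m⇒m-n≡1 {n = n} refl = trans (cong (λ k → k - + n) (ℤₚ.pos-+ 1 n)) (ring (+ n))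
  where
  ring : ∀ k → 1ℤ + k - k ≡ 1ℤ
  ring = solve-∀

pos-*-difference : ∀ a p b q → + a * + p + - + b * + q ≡ + (a ℕ.* p) - + (b ℕ.* q)
pos-*-difference a p b q = cong₂ _+_ (sym (ℤₚ.pos-* a p))
  (trans (sym (ℤₚ.neg-distribˡ-* (+ b) (+ q))) (cong -_ (sym (ℤₚ.pos-* b q))))

coprime-* : ∀ {a b c} → Coprime a b → Coprime a c → Coprime a (b ℕ.* c)
coprime-* {a} {b} {c} a⊥b a⊥c {d} (d∣a , d∣bc) = a⊥c (d∣a , ℕ.coprime-divisor d⊥b d∣bc)
  where
  d⊥b : Coprime d b
  d⊥b (e∣d , e∣b) = a⊥b (ℕ.∣-trans e∣d d∣a , e∣b)

coprime-^ : ∀ {a b} k → Coprime a b → Coprime a (b ℕ.^ k)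
coprime-^ {a} zero a⊥b = ℕ.sym (ℕ.1-coprimeTo a)
coprime-^ (suc k) a⊥b = coprime-* a⊥b (coprime-^ k a⊥b)

coprime-^-^ : ∀ {a b} k l → Coprime a b → Coprime (a ℕ.^ k) (b ℕ.^ l)
coprime-^-^ k l a⊥b = ℕ.sym (coprime-^ k (ℕ.sym (coprime-^ l a⊥b)))

bézout : ∀ p q → Coprime p q → ∃ λ a → ∃ λ b → a * + p + b * + q ≡ 1ℤ
bézout p q p⊥q with ℕ.coprime-Bézout p⊥q
... | ℕ.Bézout.+- a b 1+bq≡ap =
  + a , - + b , trans (pos-*-difference a p b q) (1+n≡m⇒m-n≡1 1+bq≡ap)
... | ℕ.Bézout.-+ a b 1+ap≡bq =
  - + a , + b , trans (ℤₚ.+-comm (- + a * + p) (+ b * + q))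
                      (trans (pos-*-difference b q a p) (1+n≡m⇒m-n≡1 1+ap≡bq))

≋-intro : ∀ {m} a b q → a - b ≡ q * + m → a ≋ b [mod m ]
≋-intro a b q e = ℤ.∣⇒∣ᵤ (ℤ.divides q e)

≋-quotient : ∀ {m} a b → a ≋ b [mod m ] → ∃ λ q → a - b ≡ q * + m
≋-quotient {m} a b d = ℤ.quotient m∣a-b , ℤ._∣_.equality m∣a-b
  where
  m∣a-b = ℤ.∣ᵤ⇒∣ {+ m} {a - b} d

pathWeight : ℕ → ℕ → ℕ → ℕ → ℕ
pathWeight n x y i = x ℕ.^ (n ℕ.∸ i) ℕ.* y ℕ.^ i

module Potential (n₀ x₀ y₀ : ℕ) where

  n x y : ℕ
  n = suc n₀
  x = suc x₀
  y = suc y₀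

  open Path n x y public

  deg : ℕ
  deg = x ℕ.+ y

  weight : ℕ → ℕ
  weight = pathWeight n x y

  weightℤ : ℕ → ℤ
  weightℤ i = + weight i

  height : ℕ → ℤ
  height k = + Σ< k weight

  height-suc : ∀ k → height (suc k) ≡ height k + weightℤ k
  height-suc k = ℤₚ.pos-+ (Σ< k weight) (weight k)

  weight-balance : ∀ i → i < n → weight (suc i) ℕ.* x ≡ weight i ℕ.* y
  weight-balance i i<n rewrite ℕₚ.+-∸-assoc 1 i<n = ring (x ℕ.^ (n ℕ.∸ suc i)) (y ℕ.^ i) x y
    where
    ring : ∀ p q a b → p ℕ.* (b ℕ.* q) ℕ.* a ≡ a ℕ.* p ℕ.* q ℕ.* b
    ring = ℕ.solve-∀

  rightSink : Vertex
  rightSink = fromℕ (suc n)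

  toℕ-inner : ∀ (u : V₀) → toℕ (inner u) ≡ suc (toℕ u)
  toℕ-inner u = cong suc (Finₚ.toℕ-inject₁ u)

  toℕ-left : ∀ (u : V₀) → toℕ (inject₁ (inject₁ u)) ≡ toℕ u
  toℕ-left u = trans (Finₚ.toℕ-inject₁ (inject₁ u)) (Finₚ.toℕ-inject₁ u)

  hVertex-inner : ∀ (u : V₀) → hVertex (inner u) ≡ height (suc (toℕ u))
  hVertex-inner u = cong height (toℕ-inner u)

  hVertex-rightSink : hVertex rightSink ≡ + F
  hVertex-rightSink = cong height (Finₚ.toℕ-fromℕ (suc n))

  hVertex-right-inner : ∀ (u : V₀) → hVertex (suc (suc u)) - hVertex (inner u) ≡ weightℤ (suc (toℕ u))
  hVertex-right-inner u rewrite hVertex-inner u | height-suc (suc (toℕ u)) = ring (height (suc (toℕ u))) (weightℤ (suc (toℕ u)))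
    where
    ring : ∀ a b → a + b - a ≡ b
    ring = solve-∀

  hVertex-left-inner : ∀ (u : V₀) → hVertex (inject₁ (inject₁ u)) - hVertex (inner u) ≡ - weightℤ (toℕ u)
  hVertex-left-inner u rewrite cong height (toℕ-left u) | hVertex-inner u | height-suc (toℕ u) = ring (height (toℕ u)) (weightℤ (toℕ u))
    where
    ring : ∀ a b → a - (a + b) ≡ - b
    ring = solve-∀

  h-cong : ∀ {σ τ : Particle} → (∀ v → σ v ≡ τ v) → h σ ≡ h τ
  h-cong e = ΣFin-cong (λ v → cong (_* hVertex v) (e v))

  h-+ : ∀ (σ τ : Particle) → h (σ +P τ) ≡ h σ + h τ
  h-+ σ τ = trans (ΣFin-cong (λ v → ℤₚ.*-distribʳ-+ (hVertex v) (σ v) (τ v)))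
                  (ΣFin-+ (λ v → σ v * hVertex v) (λ v → τ v * hVertex v))

  h-neg : ∀ (σ : Particle) → h (λ v → - σ v) ≡ - h σ
  h-neg σ = trans (ΣFin-cong (λ v → sym (ℤₚ.neg-distribˡ-* (σ v) (hVertex v))))
                  (ΣFin-neg (λ v → σ v * hVertex v))

  h-·P : ∀ (k : ℤ) (σ : Particle) → h (k ·P σ) ≡ k * h σ
  h-·P k σ = trans (ΣFin-cong (λ v → ℤₚ.*-assoc k (σ v) (hVertex v)))
                   (ΣFin-* k (λ v → σ v * hVertex v))

  h-δ : ∀ (v : Vertex) → h (δ v) ≡ hVertex v
  h-δ v = ΣFin-δ v hVertex

  h-0P : h 0P ≡ 0ℤ
  h-0P = ΣFin-zero (λ v → 0ℤ * hVertex v) (λ v → refl)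

  hInner : Particle → ℤ
  hInner σ = ΣFin (λ u → σ (inner u) * hVertex (inner u))

  h-split : ∀ (σ : Particle) → h σ ≡ hInner σ + σ rightSink * + F
  h-split σ = begin
    h σ                                                          ≡⟨ cong (_+ ΣFin (λ v → σ (suc v) * hVertex (suc v))) (ℤₚ.*-zeroʳ (σ zero)) ⟩
    0ℤ + ΣFin (λ v → σ (suc v) * hVertex (suc v))                ≡⟨ ℤₚ.+-identityˡ _ ⟩
    ΣFin (λ v → σ (suc v) * hVertex (suc v))                     ≡⟨ ΣFin-init-last n (λ v → σ (suc v) * hVertex (suc v)) ⟩
    hInner σ + σ rightSink * hVertex rightSink                   ≡⟨ cong (λ t → hInner σ + σ rightSink * t) hVertex-rightSink ⟩
    hInner σ + σ rightSink * + F                                 ∎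
    where open ≡-Reasoning

  h-agree : ∀ (σ τ : Particle) → (∀ u → σ (inner u) ≡ τ (inner u)) → h σ - h τ ≡ (σ rightSink - τ rightSink) * + F
  h-agree σ τ agree = begin
    h σ - h τ                                             ≡⟨ cong₂ _-_ (h-split σ) (h-split τ) ⟩
    hInner σ + σ rightSink * + F - (hInner τ + τ rightSink * + F) ≡⟨ cong (λ t → hInner σ + σ rightSink * + F - (t + τ rightSink * + F)) (ΣFin-cong (λ u → cong (_* hVertex (inner u)) (sym (agree u)))) ⟩
    hInner σ + σ rightSink * + F - (hInner σ + τ rightSink * + F) ≡⟨ ring (hInner σ) (σ rightSink) (τ rightSink) (+ F) ⟩
    (σ rightSink - τ rightSink) * + F                     ∎
    where
    open ≡-Reasoning
    ring : ∀ s a b f → s + a * f - (s + b * f) ≡ (a - b) * f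
    ring = solve-∀

  toℕ-θ-< : ∀ (a : Arc) → suc (toℕ a) < deg → toℕ (θ a) ≡ suc (toℕ a)
  toℕ-θ-< a lt = trans (Finₚ.toℕ-fromℕ< _) (ℕ.m<n⇒m%n≡m lt)

  toℕ-θ-wrap : ∀ (a : Arc) → suc (toℕ a) ≡ deg → toℕ (θ a) ≡ 0
  toℕ-θ-wrap a eq = trans (Finₚ.toℕ-fromℕ< _) (trans (cong (ℕ._% deg) eq) (ℕ.n%n≡0 deg))

  toℕ-θ⁻¹-zero : ∀ (a : Arc) → toℕ a ≡ 0 → toℕ (θ⁻¹ a) ≡ x₀ ℕ.+ y
  toℕ-θ⁻¹-zero a eq = trans (Finₚ.toℕ-fromℕ< _)
    (trans (cong (λ k → (k ℕ.+ (x₀ ℕ.+ y)) ℕ.% deg) eq) (ℕ.m<n⇒m%n≡m (ℕₚ.n<1+n (x₀ ℕ.+ y))))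

  toℕ-θ⁻¹-suc : ∀ (a : Arc) t → toℕ a ≡ suc t → toℕ (θ⁻¹ a) ≡ t
  toℕ-θ⁻¹-suc a t eq = begin
    toℕ (θ⁻¹ a)                          ≡⟨ Finₚ.toℕ-fromℕ< _ ⟩
    (toℕ a ℕ.+ (x₀ ℕ.+ y)) ℕ.% deg        ≡⟨ cong (λ k → (k ℕ.+ (x₀ ℕ.+ y)) ℕ.% deg) eq ⟩
    (suc t ℕ.+ (x₀ ℕ.+ y)) ℕ.% deg        ≡⟨ cong (ℕ._% deg) (sym (ℕₚ.+-suc t (x₀ ℕ.+ y))) ⟩
    (t ℕ.+ deg) ℕ.% deg                   ≡⟨ ℕ.[m+n]%n≡m%n t deg ⟩
    t ℕ.% deg                             ≡⟨ ℕ.m<n⇒m%n≡m t<deg ⟩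
    t                                     ∎
    where
    open ≡-Reasoning
    t<deg : t < deg
    t<deg = ℕₚ.<-trans (subst (t <_) (sym eq) (ℕₚ.n<1+n t)) (Finₚ.toℕ<n a)

  θ-θ⁻¹ : ∀ (a : Arc) → θ (θ⁻¹ a) ≡ a
  θ-θ⁻¹ a = Finₚ.toℕ-injective (go (toℕ a) refl)
    where
    go : ∀ t → toℕ a ≡ t → toℕ (θ (θ⁻¹ a)) ≡ toℕ a
    go zero eq = trans (toℕ-θ-wrap (θ⁻¹ a) (cong suc (toℕ-θ⁻¹-zero a eq))) (sym eq)
    go (suc t) eq = trans (toℕ-θ-< (θ⁻¹ a) (subst (_< deg) (cong suc (sym (toℕ-θ⁻¹-suc a t eq))) (subst (_< deg) eq (Finₚ.toℕ<n a))))
                          (trans (cong suc (toℕ-θ⁻¹-suc a t eq)) (sym eq))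

  headℕ-< : ∀ (u : V₀) j → j < x → headℕ u j ≡ suc (suc u)
  headℕ-< u j j<x = cong (if_then suc (suc u) else inject₁ (inject₁ u)) (dec-true (j ℕ.<? x) j<x)

  headℕ-≥ : ∀ (u : V₀) j → x ≤ j → headℕ u j ≡ inject₁ (inject₁ u)
  headℕ-≥ u j x≤j = cong (if_then suc (suc u) else inject₁ (inject₁ u)) (dec-false (j ℕ.<? x) (ℕₚ.≤⇒≯ x≤j))

  gArcℕ-closed : ∀ (u : V₀) j → gArcℕ u j ≡ weightℤ (suc (toℕ u)) * + (j ℕ.⊓ x) - weightℤ (toℕ u) * + (j ℕ.∸ x)
  gArcℕ-closed u zero = sym (ring (weightℤ (suc (toℕ u))) (weightℤ (toℕ u)))
    where
    ring : ∀ a b → a * 0ℤ - b * 0ℤ ≡ 0ℤ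
    ring = solve-∀
  gArcℕ-closed u (suc j) with j ℕ.<? x
  ... | yes j<x = begin
    gArcℕ u j + (hVertex (headℕ u j) - hVertex (inner u))   ≡⟨ cong₂ _+_ (gArcℕ-closed u j) (trans (cong (λ v → hVertex v - hVertex (inner u)) (headℕ-< u j j<x)) (hVertex-right-inner u)) ⟩
    A * + (j ℕ.⊓ x) - B * + (j ℕ.∸ x) + A                    ≡⟨ ring A B (+ (j ℕ.⊓ x)) (+ (j ℕ.∸ x)) ⟩
    A * (1ℤ + + (j ℕ.⊓ x)) - B * + (j ℕ.∸ x)                 ≡⟨ cong₂ (λ p q → A * + p - B * + q) (trans (cong suc (ℕₚ.m≤n⇒m⊓n≡m (ℕₚ.<⇒≤ j<x))) (sym (ℕₚ.m≤n⇒m⊓n≡m j<x)))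
                                                                                                  (trans (ℕₚ.m≤n⇒m∸n≡0 (ℕₚ.<⇒≤ j<x)) (sym (ℕₚ.m≤n⇒m∸n≡0 j<x))) ⟩
    A * + (suc j ℕ.⊓ x) - B * + (suc j ℕ.∸ x)                ∎
    where
    open ≡-Reasoning
    A = weightℤ (suc (toℕ u))
    B = weightℤ (toℕ u)
    ring : ∀ a b c d → a * c - b * d + a ≡ a * (1ℤ + c) - b * d
    ring = solve-∀
  ... | no j≮x = begin
    gArcℕ u j + (hVertex (headℕ u j) - hVertex (inner u))   ≡⟨ cong₂ _+_ (gArcℕ-closed u j) (trans (cong (λ v → hVertex v - hVertex (inner u)) (headℕ-≥ u j x≤j)) (hVertex-left-inner u)) ⟩
    A * + (j ℕ.⊓ x) - B * + (j ℕ.∸ x) + - B                  ≡⟨ ring A B (+ (j ℕ.⊓ x)) (+ (j ℕ.∸ x)) ⟩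
    A * + (j ℕ.⊓ x) - B * (1ℤ + + (j ℕ.∸ x))                 ≡⟨ cong₂ (λ p q → A * + p - B * + q) (trans (ℕₚ.m≥n⇒m⊓n≡n x≤j) (sym (ℕₚ.m≥n⇒m⊓n≡n (ℕₚ.m≤n⇒m≤1+n x≤j))))
                                                                                                  (sym (ℕₚ.+-∸-assoc 1 x≤j)) ⟩
    A * + (suc j ℕ.⊓ x) - B * + (suc j ℕ.∸ x)                ∎
    where
    open ≡-Reasoning
    x≤j = ℕₚ.≮⇒≥ j≮x
    A = weightℤ (suc (toℕ u))
    B = weightℤ (toℕ u)
    ring : ∀ a b c d → a * c - b * d + - b ≡ a * c - b * (1ℤ + d)
    ring = solve-∀

  gArcℕ-deg : ∀ (u : V₀) → gArcℕ u deg ≡ 0ℤ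
  gArcℕ-deg u = begin
    gArcℕ u deg                                                       ≡⟨ gArcℕ-closed u deg ⟩
    weightℤ (suc i) * + (deg ℕ.⊓ x) - weightℤ i * + (deg ℕ.∸ x)       ≡⟨ cong₂ (λ p q → weightℤ (suc i) * + p - weightℤ i * + q) (ℕₚ.m≥n⇒m⊓n≡n (ℕₚ.m≤m+n x y)) (ℕₚ.m+n∸m≡n x y) ⟩
    weightℤ (suc i) * + x - weightℤ i * + y                           ≡⟨ cong₂ _-_ (sym (ℤₚ.pos-* (weight (suc i)) x)) (sym (ℤₚ.pos-* (weight i) y)) ⟩
    + (weight (suc i) ℕ.* x) - + (weight i ℕ.* y)                     ≡⟨ cong (λ k → + k - + (weight i ℕ.* y)) (weight-balance i (Finₚ.toℕ<n u)) ⟩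
    + (weight i ℕ.* y) - + (weight i ℕ.* y)                           ≡⟨ ℤₚ.+-inverseʳ (+ (weight i ℕ.* y)) ⟩
    0ℤ                                                                ∎
    where
    open ≡-Reasoning
    i = toℕ u

  gArc-θ : ∀ (u : V₀) (a : Arc) → gArc u (θ a) ≡ gArc u a + (hVertex (head u a) - hVertex (inner u))
  gArc-θ u a with suc (toℕ a) ℕ.<? deg
  ... | yes lt = cong (gArcℕ u) (toℕ-θ-< a lt)
  ... | no nlt = trans (cong (gArcℕ u) (toℕ-θ-wrap a wrap)) (sym (trans (cong (gArcℕ u) wrap) (gArcℕ-deg u)))
    where
    wrap : suc (toℕ a) ≡ deg
    wrap = ℕₚ.≤-antisym (Finₚ.toℕ<n a) (ℕₚ.≮⇒≥ nlt)

  _[_≔_] : Rotor → V₀ → Arc → Rotor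
  (ρ [ u ≔ a ]) w = if does (w ≟ u) then a else ρ w

  ≔-same : ∀ ρ u a → (ρ [ u ≔ a ]) u ≡ a
  ≔-same ρ u a = cong (if_then a else ρ u) (dec-true (u ≟ u) refl)

  ≔-other : ∀ ρ u a w → ¬ w ≡ u → (ρ [ u ≔ a ]) w ≡ ρ w
  ≔-other ρ u a w w≢u = cong (if_then a else ρ w) (dec-false (w ≟ u) w≢u)

  g-cong : ∀ {ρ ρ' : Rotor} → (∀ u → ρ u ≡ ρ' u) → g ρ ≡ g ρ'
  g-cong e = ΣFin-cong (λ u → cong (gArc u) (e u))

  g-≔ : ∀ ρ u a → g (ρ [ u ≔ a ]) ≡ g ρ + (gArc u a - gArc u (ρ u))
  g-≔ ρ u a = trans (ΣFin-update (λ w → gArc w ((ρ [ u ≔ a ]) w)) (λ w → gArc w (ρ w)) u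
                                 (λ w w≢u → cong (gArc w) (≔-other ρ u a w w≢u)))
                    (cong (λ b → g ρ + (gArc u b - gArc u (ρ u))) (≔-same ρ u a))

  h-move : ∀ σ a b → h (λ w → σ w + δ a w - δ b w) ≡ h σ + hVertex a - hVertex b
  h-move σ a b = trans (h-+ (σ +P δ a) (λ w → - δ b w))
    (cong₂ _+_ (trans (h-+ σ (δ a)) (cong (_+_ (h σ)) (h-δ a))) (trans (h-neg (δ b)) (cong -_ (h-δ b))))

  h-unmove : ∀ σ a b → h (λ w → σ w - δ a w + δ b w) ≡ h σ - hVertex a + hVertex b
  h-unmove σ a b = trans (h-+ (λ w → σ w - δ a w) (δ b))
    (cong₂ _+_ (trans (h-+ σ (λ w → - δ a w)) (cong (_+_ (h σ)) (trans (h-neg (δ a)) (cong -_ (h-δ a))))) (h-δ b))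

  Φ : Config → ℤ
  Φ (ρ , σ) = g ρ - h σ

  Φ-routing⁺ : ∀ u c → Φ (routing⁺ u c) ≡ Φ c
  Φ-routing⁺ u (ρ , σ) = begin
    g (ρ [ u ≔ θ (ρ u) ]) - h (λ w → σ w + δ H w - δ I w)   ≡⟨ cong₂ _-_ (g-≔ ρ u (θ (ρ u))) (h-move σ H I) ⟩
    g ρ + (gArc u (θ (ρ u)) - A) - (h σ + hVertex H - hVertex I)  ≡⟨ cong (λ t → g ρ + (t - A) - (h σ + hVertex H - hVertex I)) (gArc-θ u (ρ u)) ⟩
    g ρ + (A + (hVertex H - hVertex I) - A) - (h σ + hVertex H - hVertex I) ≡⟨ ring (g ρ) (h σ) A (hVertex H) (hVertex I) ⟩
    g ρ - h σ                                                 ∎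
    where
    open ≡-Reasoning
    H = head u (ρ u)
    I = inner u
    A = gArc u (ρ u)
    ring : ∀ G S A H I → G + (A + (H - I) - A) - (S + H - I) ≡ G - S
    ring = solve-∀

  Φ-routing⁻ : ∀ u c → Φ (routing⁻ u c) ≡ Φ c
  Φ-routing⁻ u (ρ , σ) = begin
    g (ρ [ u ≔ a ]) - h (λ w → σ w - δ H w + δ I w)           ≡⟨ cong₂ _-_ (g-≔ ρ u a) (h-unmove σ H I) ⟩
    g ρ + (A - gArc u (ρ u)) - (h σ - hVertex H + hVertex I)  ≡⟨ cong (λ b → g ρ + (A - gArc u b) - (h σ - hVertex H + hVertex I)) (sym (θ-θ⁻¹ (ρ u))) ⟩
    g ρ + (A - gArc u (θ a)) - (h σ - hVertex H + hVertex I)  ≡⟨ cong (λ t → g ρ + (A - t) - (h σ - hVertex H + hVertex I)) (gArc-θ u a) ⟩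
    g ρ + (A - (A + (hVertex H - hVertex I))) - (h σ - hVertex H + hVertex I) ≡⟨ ring (g ρ) (h σ) A (hVertex H) (hVertex I) ⟩
    g ρ - h σ                                                 ∎
    where
    open ≡-Reasoning
    a = θ⁻¹ (ρ u)
    H = head u a
    I = inner u
    A = gArc u a
    ring : ∀ G S A H I → G + (A - (A + (H - I))) - (S - H + I) ≡ G - S
    ring = solve-∀

  Φ-iter : ∀ (f : Config → Config) → (∀ c → Φ (f c) ≡ Φ c) → ∀ k c → Φ (iter f k c) ≡ Φ c
  Φ-iter f Φ-f zero c = refl
  Φ-iter f Φ-f (suc k) c = trans (Φ-f (iter f k c)) (Φ-iter f Φ-f k c)

  Φ-routingPow : ∀ u k c → Φ (routingPow u k c) ≡ Φ c
  Φ-routingPow u (+ k) = Φ-iter (routing⁺ u) (Φ-routing⁺ u) k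
  Φ-routingPow u -[1+ k ] = Φ-iter (routing⁻ u) (Φ-routing⁻ u) (suc k)

  Φ-routing : ∀ r c → Φ (routing r c) ≡ Φ c
  Φ-routing r c = go (allFin n)
    where
    go : ∀ L → Φ (foldr (λ u c' → routingPow u (r u) c') c L) ≡ Φ c
    go [] = refl
    go (u ∷ L) = trans (Φ-routingPow u (r u) _) (go L)

  Φ-≈C : ∀ {c c'} → c ≈C c' → Φ c ≡ Φ c'
  Φ-≈C {ρ , σ} {ρ' , σ'} (ρ≗ρ' , σ≗σ') = cong₂ _-_ (g-cong ρ≗ρ') (h-cong σ≗σ')

  Φ-~ : ∀ {c c'} → c ~ c' → Φ c ≡ Φ c'
  Φ-~ {c} (r , e) = trans (sym (Φ-routing r c)) (Φ-≈C e)

  ~R⇒g≡ : ∀ {ρ ρ' : Rotor} → ρ ~R ρ' → g ρ ≡ g ρ'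
  ~R⇒g≡ {ρ} {ρ'} (σ , c) = i-k≡j-k⇒i≡j (g ρ) (g ρ') (h σ) (Φ-~ c)

  ~P⇒h≡ : ∀ {σ σ' : Particle} → σ ~P σ' → h σ ≡ h σ'
  ~P⇒h≡ {σ} {σ'} (ρ , c) = k-i≡k-j⇒i≡j (h σ) (h σ') (g ρ) (Φ-~ c)

  ~S⇒h≋ : ∀ (σ σ' : Particle) → σ ~S σ' → h σ ≋ h σ' [mod F ]
  ~S⇒h≋ σ σ' (σ₁ , σ₁~σ , agree) =
    ≋-intro (h σ) (h σ') (σ₁ rightSink - σ' rightSink) (trans (cong (_- h σ') (sym (~P⇒h≡ σ₁~σ))) (h-agree σ₁ σ' agree))

  ~R⇒g≋ : ∀ (ρ ρ' : Rotor) → ρ ~R ρ' → g ρ ≋ g ρ' [mod F ]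
  ~R⇒g≋ ρ ρ' ρ~ρ' = ≋-intro (g ρ) (g ρ') 0ℤ (trans (cong (_- g ρ') (~R⇒g≡ ρ~ρ')) (trans (ℤₚ.+-inverseʳ (g ρ')) (sym (ℤₚ.*-zeroˡ (+ F)))))

  routing∞-g : ∀ (ρ ρ' : Rotor) (σ σ' : Particle) → (ρ' , σ') ∈routing∞ (ρ , σ) → g ρ' ≋ g ρ - h σ [mod F ]
  routing∞-g ρ ρ' σ σ' (c , stable) = ≋-intro (g ρ') (g ρ - h σ) (σ' rightSink - 0ℤ) (begin
    g ρ' - (g ρ - h σ)         ≡⟨ cong (_-_ (g ρ')) (Φ-~ c) ⟩
    g ρ' - (g ρ' - h σ')       ≡⟨ ring (g ρ') (h σ') ⟩
    h σ' - 0ℤ                  ≡⟨ cong (_-_ (h σ')) (sym h-0P) ⟩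
    h σ' - h 0P                ≡⟨ h-agree σ' 0P stable ⟩
    (σ' rightSink - 0ℤ) * + F  ∎)
    where
    open ≡-Reasoning
    ring : ∀ G S → G - (G - S) ≡ S - 0ℤ
    ring = solve-∀

module Routing (n₀ x₀ y₀ : ℕ) where

  open Potential n₀ x₀ y₀ public

  -- A lifted rotor position (q , a) stands for the q·deg + toℕ a arcs served so far; α, β and H
  -- count the rightward, leftward and all of them.
  Lift : Set
  Lift = ℤ × Arc

  αℕ βℕ Hℕ : ℤ → ℕ → ℤ
  αℕ q t = q * + x + + (t ℕ.⊓ x)
  βℕ q t = q * + y + + (t ℕ.∸ x)
  Hℕ q t = q * + deg + + t

  α β H : Lift → ℤ
  α (q , a) = αℕ q (toℕ a)
  β (q , a) = βℕ q (toℕ a)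
  H (q , a) = Hℕ q (toℕ a)

  αℕ-suc-< : ∀ q t → t < x → αℕ q (suc t) ≡ αℕ q t + 1ℤ
  αℕ-suc-< q t t<x rewrite ℕₚ.m≤n⇒m⊓n≡m t<x | ℕₚ.m≤n⇒m⊓n≡m (ℕₚ.<⇒≤ t<x) = +-pos-suc (q * + x) t

  βℕ-suc-< : ∀ q t → t < x → βℕ q (suc t) ≡ βℕ q t
  βℕ-suc-< q t t<x rewrite ℕₚ.m≤n⇒m∸n≡0 t<x | ℕₚ.m≤n⇒m∸n≡0 (ℕₚ.<⇒≤ t<x) = refl

  αℕ-suc-≥ : ∀ q t → x ≤ t → αℕ q (suc t) ≡ αℕ q t
  αℕ-suc-≥ q t x≤t rewrite ℕₚ.m≥n⇒m⊓n≡n (ℕₚ.m≤n⇒m≤1+n x≤t) | ℕₚ.m≥n⇒m⊓n≡n x≤t = refl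

  βℕ-suc-≥ : ∀ q t → x ≤ t → βℕ q (suc t) ≡ βℕ q t + 1ℤ
  βℕ-suc-≥ q t x≤t rewrite ℕₚ.+-∸-assoc 1 x≤t = +-pos-suc (q * + y) (t ℕ.∸ x)

  αℕ-wrap : ∀ q → αℕ (q + 1ℤ) 0 ≡ αℕ q (x ℕ.+ y₀)
  αℕ-wrap q = trans (ring q (+ x)) (cong (λ m → q * + x + + m) (sym (ℕₚ.m≥n⇒m⊓n≡n (ℕₚ.m≤m+n x y₀))))
    where
    ring : ∀ q k → (q + 1ℤ) * k + 0ℤ ≡ q * k + k
    ring = solve-∀

  βℕ-wrap : ∀ q → βℕ (q + 1ℤ) 0 ≡ βℕ q (x ℕ.+ y₀) + 1ℤ
  βℕ-wrap q = begin
    (q + 1ℤ) * + y + 0ℤ                ≡⟨ ring q (+ y) ⟩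
    q * + y + + y                       ≡⟨ +-pos-suc (q * + y) y₀ ⟩
    q * + y + + y₀ + 1ℤ                 ≡⟨ cong (λ m → q * + y + + m + 1ℤ) (sym (ℕₚ.m+n∸m≡n x y₀)) ⟩
    q * + y + + (x ℕ.+ y₀ ℕ.∸ x) + 1ℤ   ∎
    where
    open ≡-Reasoning
    ring : ∀ q k → (q + 1ℤ) * k + 0ℤ ≡ q * k + k
    ring = solve-∀

  Hℕ≡αℕ+βℕ : ∀ q t → Hℕ q t ≡ αℕ q t + βℕ q t
  Hℕ≡αℕ+βℕ q t = begin
    q * + (x ℕ.+ y) + + t                           ≡⟨ cong₂ (λ d s → q * d + s) (ℤₚ.pos-+ x y) (cong +_ (sym split)) ⟩
    q * (+ x + + y) + + (t ℕ.⊓ x ℕ.+ (t ℕ.∸ x))     ≡⟨ cong (_+_ (q * (+ x + + y))) (ℤₚ.pos-+ (t ℕ.⊓ x) (t ℕ.∸ x)) ⟩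
    q * (+ x + + y) + (+ (t ℕ.⊓ x) + + (t ℕ.∸ x))   ≡⟨ ring q (+ x) (+ y) (+ (t ℕ.⊓ x)) (+ (t ℕ.∸ x)) ⟩
    αℕ q t + βℕ q t                                  ∎
    where
    open ≡-Reasoning
    split : t ℕ.⊓ x ℕ.+ (t ℕ.∸ x) ≡ t
    split = trans (cong (ℕ._+ (t ℕ.∸ x)) (ℕₚ.⊓-comm t x)) (ℕₚ.m⊓n+n∸m≡n x t)
    ring : ∀ q x y a b → q * (x + y) + (a + b) ≡ q * x + a + (q * y + b)
    ring = solve-∀

  carry : Arc → ℤ
  carry a = if does (suc (toℕ a) ℕ.<? deg) then 0ℤ else 1ℤ

  borrow : Arc → ℤ
  borrow a = if does (toℕ a ℕ.≟ 0) then 1ℤ else 0ℤ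

  step⁺ step⁻ : Lift → Lift
  step⁺ (q , a) = q + carry a , θ a
  step⁻ (q , a) = q - borrow a , θ⁻¹ a

  x<deg : x < deg
  x<deg = ℕₚ.m<m+n x (s≤s z≤n)

  carry-< : ∀ a → suc (toℕ a) < deg → carry a ≡ 0ℤ
  carry-< a lt = cong (if_then 0ℤ else 1ℤ) (dec-true (suc (toℕ a) ℕ.<? deg) lt)

  carry-wrap : ∀ a → suc (toℕ a) ≡ deg → carry a ≡ 1ℤ
  carry-wrap a wrap = cong (if_then 0ℤ else 1ℤ) (dec-false (suc (toℕ a) ℕ.<? deg) (ℕₚ.<-irrefl wrap))

  step⁺-inside : ∀ (f : ℤ → ℕ → ℤ) q a → suc (toℕ a) < deg → f (q + carry a) (toℕ (θ a)) ≡ f q (suc (toℕ a))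
  step⁺-inside f q a lt = cong₂ f (trans (cong (_+_ q) (carry-< a lt)) (ℤₚ.+-identityʳ q)) (toℕ-θ-< a lt)

  step⁺-wrap : ∀ (f : ℤ → ℕ → ℤ) q a → suc (toℕ a) ≡ deg → f (q + carry a) (toℕ (θ a)) ≡ f (q + 1ℤ) 0
  step⁺-wrap f q a wrap = cong₂ f (cong (_+_ q) (carry-wrap a wrap)) (toℕ-θ-wrap a wrap)

  αβ-step⁺-right : ∀ s → toℕ (proj₂ s) < x → α (step⁺ s) ≡ α s + 1ℤ × β (step⁺ s) ≡ β s
  αβ-step⁺-right (q , a) a<x =
    trans (step⁺-inside αℕ q a lt) (αℕ-suc-< q (toℕ a) a<x) ,
    trans (step⁺-inside βℕ q a lt) (βℕ-suc-< q (toℕ a) a<x)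
    where
    lt = ℕₚ.<-≤-trans (s≤s a<x) x<deg

  αβ-step⁺-left : ∀ s → x ≤ toℕ (proj₂ s) → α (step⁺ s) ≡ α s × β (step⁺ s) ≡ β s + 1ℤ
  αβ-step⁺-left (q , a) x≤a with suc (toℕ a) ℕ.<? deg
  ... | yes lt =
    trans (step⁺-inside αℕ q a lt) (αℕ-suc-≥ q (toℕ a) x≤a) ,
    trans (step⁺-inside βℕ q a lt) (βℕ-suc-≥ q (toℕ a) x≤a)
  ... | no ¬lt =
    trans (step⁺-wrap αℕ q a wrap) (trans (αℕ-wrap q) (cong (αℕ q) (sym a≡))) ,
    trans (step⁺-wrap βℕ q a wrap) (trans (βℕ-wrap q) (cong (λ t → βℕ q t + 1ℤ) (sym a≡)))
    where
    wrap : suc (toℕ a) ≡ deg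
    wrap = ℕₚ.≤-antisym (Finₚ.toℕ<n a) (ℕₚ.≮⇒≥ ¬lt)
    a≡ : toℕ a ≡ x ℕ.+ y₀
    a≡ = ℕₚ.suc-injective (trans wrap (ℕₚ.+-suc x y₀))

  H≡α+β : ∀ s → H s ≡ α s + β s
  H≡α+β (q , a) = Hℕ≡αℕ+βℕ q (toℕ a)

  H-step⁺ : ∀ s → H (step⁺ s) ≡ H s + 1ℤ
  H-step⁺ s with toℕ (proj₂ s) ℕ.<? x
  ... | yes a<x = begin
    H (step⁺ s)                ≡⟨ H≡α+β (step⁺ s) ⟩
    α (step⁺ s) + β (step⁺ s)  ≡⟨ cong₂ _+_ (proj₁ (αβ-step⁺-right s a<x)) (proj₂ (αβ-step⁺-right s a<x)) ⟩
    α s + 1ℤ + β s             ≡⟨ ring (α s) (β s) ⟩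
    α s + β s + 1ℤ             ≡⟨ cong (_+ 1ℤ) (H≡α+β s) ⟨
    H s + 1ℤ                   ∎
    where
    open ≡-Reasoning
    ring : ∀ a b → a + 1ℤ + b ≡ a + b + 1ℤ
    ring = solve-∀
  ... | no a≮x = begin
    H (step⁺ s)                ≡⟨ H≡α+β (step⁺ s) ⟩
    α (step⁺ s) + β (step⁺ s)  ≡⟨ cong₂ _+_ (proj₁ (αβ-step⁺-left s x≤a)) (proj₂ (αβ-step⁺-left s x≤a)) ⟩
    α s + (β s + 1ℤ)           ≡⟨ ℤₚ.+-assoc (α s) (β s) 1ℤ ⟨
    α s + β s + 1ℤ             ≡⟨ cong (_+ 1ℤ) (H≡α+β s) ⟨
    H s + 1ℤ                   ∎
    where
    open ≡-Reasoning
    x≤a = ℕₚ.≮⇒≥ a≮x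

  step⁺-step⁻ : ∀ s → step⁺ (step⁻ s) ≡ s
  step⁺-step⁻ (q , a) = cong₂ _,_ (turns (toℕ a) refl) (θ-θ⁻¹ a)
    where
    turns : ∀ t → toℕ a ≡ t → q - borrow a + carry (θ⁻¹ a) ≡ q
    turns zero a≡0 = trans (cong₂ (λ b c → q - b + c) borrow≡1 (carry-wrap (θ⁻¹ a) (cong suc (toℕ-θ⁻¹-zero a a≡0)))) (ring q)
      where
      borrow≡1 = cong (if_then 1ℤ else 0ℤ) (dec-true (toℕ a ℕ.≟ 0) a≡0)
      ring : ∀ q → q - 1ℤ + 1ℤ ≡ q
      ring = solve-∀
    turns (suc t) a≡1+t = trans (cong₂ (λ b c → q - b + c) borrow≡0 (carry-< (θ⁻¹ a) lt)) (ring q)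
      where
      borrow≡0 = cong (if_then 1ℤ else 0ℤ) (dec-false (toℕ a ℕ.≟ 0) (λ a≡0 → ℕₚ.0≢1+n (trans (sym a≡0) a≡1+t)))
      lt : suc (toℕ (θ⁻¹ a)) < deg
      lt = subst (λ k → suc k < deg) (sym (toℕ-θ⁻¹-suc a t a≡1+t)) (subst (_< deg) a≡1+t (Finₚ.toℕ<n a))
      ring : ∀ q → q - 0ℤ + 0ℤ ≡ q
      ring = solve-∀

  H-step⁻ : ∀ s → H (step⁻ s) ≡ H s - 1ℤ
  H-step⁻ s = trans (ring (H (step⁻ s))) (cong (_- 1ℤ) (trans (sym (H-step⁺ (step⁻ s))) (cong H (step⁺-step⁻ s))))
    where
    ring : ∀ a → a ≡ a + 1ℤ - 1ℤ
    ring = solve-∀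

  lift^ : ℤ → Lift → Lift
  lift^ (+ k) s = fold s step⁺ k
  lift^ -[1+ k ] s = fold s step⁻ (suc k)

  H-lift^ : ∀ k s → H (lift^ k s) ≡ H s + k
  H-lift^ (+ k) s = up k
    where
    up : ∀ k → H (fold s step⁺ k) ≡ H s + + k
    up zero = sym (ℤₚ.+-identityʳ (H s))
    up (suc k) = trans (H-step⁺ (fold s step⁺ k)) (trans (cong (_+ 1ℤ) (up k)) (sym (+-pos-suc (H s) k)))
  H-lift^ -[1+ k ] s = down (suc k)
    where
    down : ∀ k → H (fold s step⁻ k) ≡ H s - + k
    down zero = sym (ℤₚ.+-identityʳ (H s))
    down (suc k) = trans (H-step⁻ (fold s step⁻ k)) (trans (cong (_- 1ℤ) (down k)) (trans (ring (H s) (+ k)) (cong (λ t → H s - t) (sym (pos-suc k)))))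
      where
      ring : ∀ a b → a - b - 1ℤ ≡ a - (b + 1ℤ)
      ring = solve-∀

  Δfire : V₀ → Lift → Lift → Particle
  Δfire u s₀ s w = (α s - α s₀) * δ (suc (suc u)) w + (β s - β s₀) * δ (inject₁ (inject₁ u)) w
                   - (H s - H s₀) * δ (inner u) w

  Δfire-step⁺ : ∀ u s₀ s w → Δfire u s₀ (step⁺ s) w ≡ Δfire u s₀ s w + δ (head u (proj₂ s)) w - δ (inner u) w
  Δfire-step⁺ u s₀ s@(q , a) w with toℕ a ℕ.<? x
  ... | yes a<x rewrite headℕ-< u (toℕ a) a<x | proj₁ (αβ-step⁺-right s a<x) | proj₂ (αβ-step⁺-right s a<x) | H-step⁺ s =
    ring (α s) (β s) (H s) (α s₀) (β s₀) (H s₀) (δ (suc (suc u)) w) (δ (inject₁ (inject₁ u)) w) (δ (inner u) w)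
    where
    ring : ∀ A B C A₀ B₀ C₀ r l i → (A + 1ℤ - A₀) * r + (B - B₀) * l - (C + 1ℤ - C₀) * i
                                   ≡ (A - A₀) * r + (B - B₀) * l - (C - C₀) * i + r - i
    ring = solve-∀
  ... | no a≮x rewrite headℕ-≥ u (toℕ a) (ℕₚ.≮⇒≥ a≮x) | proj₁ (αβ-step⁺-left s (ℕₚ.≮⇒≥ a≮x)) | proj₂ (αβ-step⁺-left s (ℕₚ.≮⇒≥ a≮x)) | H-step⁺ s =
    ring (α s) (β s) (H s) (α s₀) (β s₀) (H s₀) (δ (suc (suc u)) w) (δ (inject₁ (inject₁ u)) w) (δ (inner u) w)
    where
    ring : ∀ A B C A₀ B₀ C₀ r l i → (A - A₀) * r + (B + 1ℤ - B₀) * l - (C + 1ℤ - C₀) * i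
                                   ≡ (A - A₀) * r + (B - B₀) * l - (C - C₀) * i + l - i
    ring = solve-∀

  fired : Config → V₀ → Lift → Lift → Config
  fired (ρ , σ) u s₀ s = ρ [ u ≔ proj₂ s ] , (λ w → σ w + Δfire u s₀ s w)

  fired-start : ∀ c u s₀ → proj₂ s₀ ≡ proj₁ c u → c ≈C fired c u s₀ s₀
  fired-start (ρ , σ) u s₀ s₀≡ρu = rotor , (λ w → sym (ring (σ w) (α s₀) (β s₀) (H s₀) _ _ _))
    where
    rotor : ∀ w → ρ w ≡ (ρ [ u ≔ proj₂ s₀ ]) w
    rotor w with w ≟ u
    ... | yes refl = sym s₀≡ρu
    ... | no _ = refl
    ring : ∀ s A B C r l i → s + ((A - A) * r + (B - B) * l - (C - C) * i) ≡ s
    ring = solve-∀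

  ≔-rotate : ∀ ρ u a (f : Arc → Arc) w → (if does (w ≟ u) then f ((ρ [ u ≔ a ]) u) else (ρ [ u ≔ a ]) w) ≡ (ρ [ u ≔ f a ]) w
  ≔-rotate ρ u a f w with w ≟ u
  ... | yes refl = cong f (≔-same ρ u a)
  ... | no _ = refl

  fired-step⁺ : ∀ c u s₀ s → routing⁺ u (fired c u s₀ s) ≈C fired c u s₀ (step⁺ s)
  fired-step⁺ (ρ , σ) u s₀ s@(q , a) = ≔-rotate ρ u a θ , particles
    where
    particles : ∀ w → σ w + Δfire u s₀ s w + δ (head u ((ρ [ u ≔ a ]) u)) w - δ (inner u) w ≡ σ w + Δfire u s₀ (step⁺ s) w
    particles w rewrite ≔-same ρ u a | Δfire-step⁺ u s₀ s w =
      ring (σ w) (Δfire u s₀ s w) (δ (head u a) w) (δ (inner u) w)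
      where
      ring : ∀ s d e i → s + d + e - i ≡ s + (d + e - i)
      ring = solve-∀

  fired-step⁻ : ∀ c u s₀ s → routing⁻ u (fired c u s₀ s) ≈C fired c u s₀ (step⁻ s)
  fired-step⁻ (ρ , σ) u s₀ s@(q , a) = ≔-rotate ρ u a θ⁻¹ , particles
    where
    particles : ∀ w → σ w + Δfire u s₀ s w - δ (head u (θ⁻¹ ((ρ [ u ≔ a ]) u))) w + δ (inner u) w ≡ σ w + Δfire u s₀ (step⁻ s) w
    particles w rewrite ≔-same ρ u a = begin
      σ w + Δfire u s₀ s w - E + I                     ≡⟨ cong (λ t → σ w + Δfire u s₀ t w - E + I) (sym (step⁺-step⁻ s)) ⟩
      σ w + Δfire u s₀ (step⁺ (step⁻ s)) w - E + I     ≡⟨ cong (λ t → σ w + t - E + I) (Δfire-step⁺ u s₀ (step⁻ s) w) ⟩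
      σ w + (Δfire u s₀ (step⁻ s) w + E - I) - E + I   ≡⟨ ring (σ w) (Δfire u s₀ (step⁻ s) w) E I ⟩
      σ w + Δfire u s₀ (step⁻ s) w                     ∎
      where
      open ≡-Reasoning
      E = δ (head u (θ⁻¹ a)) w
      I = δ (inner u) w
      ring : ∀ s d e i → s + (d + e - i) - e + i ≡ s + d
      ring = solve-∀

  ≈C-trans : ∀ {a b c} → a ≈C b → b ≈C c → a ≈C c
  ≈C-trans {_ , _} {_ , _} {_ , _} (p₁ , p₂) (q₁ , q₂) = (λ u → trans (p₁ u) (q₁ u)) , (λ v → trans (p₂ v) (q₂ v))

  routing⁺-cong : ∀ u {c c'} → c ≈C c' → routing⁺ u c ≈C routing⁺ u c'
  routing⁺-cong u {ρ , σ} {ρ' , σ'} (ρ≗ , σ≗) =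
    (λ w → cong₂ (λ a b → if does (w ≟ u) then θ a else b) (ρ≗ u) (ρ≗ w)) ,
    (λ w → cong₂ (λ p a → p + δ (head u a) w - δ (inner u) w) (σ≗ w) (ρ≗ u))

  routing⁻-cong : ∀ u {c c'} → c ≈C c' → routing⁻ u c ≈C routing⁻ u c'
  routing⁻-cong u {ρ , σ} {ρ' , σ'} (ρ≗ , σ≗) =
    (λ w → cong₂ (λ a b → if does (w ≟ u) then θ⁻¹ a else b) (ρ≗ u) (ρ≗ w)) ,
    (λ w → cong₂ (λ p a → p - δ (head u (θ⁻¹ a)) w + δ (inner u) w) (σ≗ w) (ρ≗ u))

  iter-fired : ∀ u (f : Config → Config) (step : Lift → Lift) →
               (∀ {c c'} → c ≈C c' → f c ≈C f c') → (∀ c s₀ s → f (fired c u s₀ s) ≈C fired c u s₀ (step s)) →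
               ∀ c s₀ → proj₂ s₀ ≡ proj₁ c u → ∀ k → iter f k c ≈C fired c u s₀ (fold s₀ step k)
  iter-fired u f step f-cong f-step c s₀ start zero = fired-start c u s₀ start
  iter-fired u f step f-cong f-step c s₀ start (suc k) =
    ≈C-trans (f-cong (iter-fired u f step f-cong f-step c s₀ start k)) (f-step c s₀ (fold s₀ step k))

  routingPow-fired : ∀ u k c → routingPow u k c ≈C fired c u (0ℤ , proj₁ c u) (lift^ k (0ℤ , proj₁ c u))
  routingPow-fired u (+ k) c = iter-fired u (routing⁺ u) step⁺ (routing⁺-cong u) (λ c → fired-step⁺ c u) c _ refl k
  routingPow-fired u -[1+ k ] c = iter-fired u (routing⁻ u) step⁻ (routing⁻-cong u) (λ c → fired-step⁻ c u) c _ refl (suc k)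

  routingPow-cong : ∀ u k {c c'} → c ≈C c' → routingPow u k c ≈C routingPow u k c'
  routingPow-cong u (+ k) = go k
    where
    go : ∀ k {c c'} → c ≈C c' → iter (routing⁺ u) k c ≈C iter (routing⁺ u) k c'
    go zero e = e
    go (suc k) e = routing⁺-cong u (go k e)
  routingPow-cong u -[1+ k ] = go (suc k)
    where
    go : ∀ k {c c'} → c ≈C c' → iter (routing⁻ u) k c ≈C iter (routing⁻ u) k c'
    go zero e = e
    go (suc k) e = routing⁻-cong u (go k e)

  endLift : Rotor → (V₀ → ℤ) → V₀ → Lift
  endLift ρ r u = lift^ (r u) (0ℤ , ρ u)

  Δrouting : Rotor → (V₀ → ℤ) → Particle
  Δrouting ρ r w = ΣFin (λ u → Δfire u (0ℤ , ρ u) (endLift ρ r u) w)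

  _[_≔ends_] : Rotor → List V₀ → (V₀ → Lift) → Rotor
  ρ [ [] ≔ends S ] = ρ
  ρ [ u ∷ L ≔ends S ] = (ρ [ L ≔ends S ]) [ u ≔ proj₂ (S u) ]

  ≔ends-∉ : ∀ ρ S u L → All (λ v → ¬ u ≡ v) L → (ρ [ L ≔ends S ]) u ≡ ρ u
  ≔ends-∉ ρ S u [] [] = refl
  ≔ends-∉ ρ S u (v ∷ L) (u≢v ∷ u∉L) = trans (≔-other (ρ [ L ≔ends S ]) v (proj₂ (S v)) u u≢v) (≔ends-∉ ρ S u L u∉L)

  ≔ends-∈ : ∀ ρ S w L → w ∈ L → (ρ [ L ≔ends S ]) w ≡ proj₂ (S w)
  ≔ends-∈ ρ S w (u ∷ L) (here refl) = ≔-same (ρ [ L ≔ends S ]) w (proj₂ (S w))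
  ≔ends-∈ ρ S w (u ∷ L) (there w∈L) with w ≟ u
  ... | yes refl = refl
  ... | no _ = ≔ends-∈ ρ S w L w∈L

  routing-list : ∀ (r : V₀ → ℤ) ρ σ (L : List V₀) → Unique L →
                 foldr (λ u c → routingPow u (r u) c) (ρ , σ) L ≈C
                 (ρ [ L ≔ends endLift ρ r ] , λ w → σ w + Σlist L (λ u → Δfire u (0ℤ , ρ u) (endLift ρ r u) w))
  routing-list r ρ σ [] _ = (λ _ → refl) , (λ w → sym (ℤₚ.+-identityʳ (σ w)))
  routing-list r ρ σ (u ∷ L) (u∉L ∷ unique) =
    ≈C-trans (routingPow-cong u (r u) (routing-list r ρ σ L unique))
    (≈C-trans (routingPow-fired u (r u) (ρL , σL))
      ((λ w → cong (λ a → (ρL [ u ≔ proj₂ (lift^ (r u) (0ℤ , a)) ]) w) ρLu≡ρu) ,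
       (λ w → trans (cong (λ a → σL w + Δfire u (0ℤ , a) (lift^ (r u) (0ℤ , a)) w) ρLu≡ρu)
                    (ring (σ w) (Σlist L (λ v → Δfire v (0ℤ , ρ v) (endLift ρ r v) w)) (Δfire u (0ℤ , ρ u) (endLift ρ r u) w)))))
    where
    ρL = ρ [ L ≔ends endLift ρ r ]
    σL : Particle
    σL w = σ w + Σlist L (λ v → Δfire v (0ℤ , ρ v) (endLift ρ r v) w)
    ρLu≡ρu : ρL u ≡ ρ u
    ρLu≡ρu = ≔ends-∉ ρ (endLift ρ r) u L u∉L
    ring : ∀ a b c → a + b + c ≡ a + (c + b)
    ring = solve-∀

  routing-formula : ∀ (r : V₀ → ℤ) ρ σ → routing r (ρ , σ) ≈C ((λ u → proj₂ (endLift ρ r u)) , λ w → σ w + Δrouting ρ r w)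
  routing-formula r ρ σ = ≈C-trans (routing-list r ρ σ (allFin n) (Uniqueₚ.allFin⁺ n))
    ((λ w → ≔ends-∈ ρ (endLift ρ r) w (allFin n) (Listₚ.∈-allFin w)) ,
     (λ w → cong (_+_ (σ w)) (Σlist-tabulate (λ u → u) (λ u → Δfire u (0ℤ , ρ u) (endLift ρ r u) w))))

  H-injective : ∀ s s' → H s ≡ H s' → s ≡ s'
  H-injective (q , a) (q' , a') eq with quotient-remainder-unique q q' (Finₚ.toℕ<n a) (Finₚ.toℕ<n a') eq
  ... | q≡q' , a≡a' = cong₂ _,_ q≡q' (Finₚ.toℕ-injective a≡a')

  arcIndex : Rotor → ℕ → ℕ
  arcIndex ρ i with i ℕ.<? n
  ... | yes i<n = toℕ (ρ (fromℕ< i<n))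
  ... | no _ = 0

  arcIndex-toℕ : ∀ ρ u → arcIndex ρ (toℕ u) ≡ toℕ (ρ u)
  arcIndex-toℕ ρ u with toℕ u ℕ.<? n
  ... | yes lt = cong (λ v → toℕ (ρ v)) (Finₚ.fromℕ<-toℕ u lt)
  ... | no ¬lt = ⊥-elim (¬lt (Finₚ.toℕ<n u))

  arcIndex-<deg : ∀ ρ i → arcIndex ρ i < deg
  arcIndex-<deg ρ i with i ℕ.<? n
  ... | yes i<n = Finₚ.toℕ<n (ρ (fromℕ< i<n))
  ... | no _ = s≤s z≤n

  arcIndex-n : ∀ ρ → arcIndex ρ n ≡ 0
  arcIndex-n ρ with n ℕ.<? n
  ... | yes n<n = ⊥-elim (ℕₚ.<-irrefl refl n<n)
  ... | no _ = refl

  -- Among the arcs of u_v before ρ(u_v), how many point right and left; 0 at both sinks.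
  rightPart leftPart : Rotor → ℕ → ℤ
  rightPart ρ zero = 0ℤ
  rightPart ρ (suc i) = + (arcIndex ρ i ℕ.⊓ x)
  leftPart ρ zero = 0ℤ
  leftPart ρ (suc i) = + (arcIndex ρ i ℕ.∸ x)

  leftPart-sink : ∀ ρ → leftPart ρ (suc n) ≡ 0ℤ
  leftPart-sink ρ = cong (λ t → + (t ℕ.∸ x)) (arcIndex-n ρ)

  -- u_k makes M k full turns and then moves on from ρ(u_k) to ρ'(u_k).
  routingVector : Rotor → Rotor → (ℕ → ℤ) → V₀ → ℤ
  routingVector ρ ρ' M u = + toℕ (ρ' u) - + toℕ (ρ u) + M (suc (toℕ u)) * + deg

  endLift-routingVector : ∀ ρ ρ' M u → endLift ρ (routingVector ρ ρ' M) u ≡ (M (suc (toℕ u)) , ρ' u)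
  endLift-routingVector ρ ρ' M u = H-injective _ _ (trans (H-lift^ (routingVector ρ ρ' M u) (0ℤ , ρ u))
    (ring (+ deg) (+ toℕ (ρ u)) (+ toℕ (ρ' u)) (M (suc (toℕ u)))))
    where
    ring : ∀ k t t' m → 0ℤ * k + t + (t' - t + m * k) ≡ m * k + t'
    ring = solve-∀

  -- netFlow ρ ρ' M e is the net number of particles the routing above carries from u_e to u_{e+1}.
  rightFlow leftFlow netFlow : Rotor → Rotor → (ℕ → ℤ) → ℕ → ℤ
  rightFlow ρ ρ' M v = + x * M v + rightPart ρ' v - rightPart ρ v
  leftFlow ρ ρ' M v = + y * M v + leftPart ρ' v - leftPart ρ v
  netFlow ρ ρ' M e = rightFlow ρ ρ' M e - leftFlow ρ ρ' M (suc e)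

  data VertexView : Vertex → Set where
    at-left : VertexView zero
    at-inner : ∀ u → VertexView (inner u)
    at-right : VertexView rightSink

  vertexView : ∀ w → VertexView w
  vertexView zero = at-left
  vertexView (suc w) with toℕ w ℕ.<? n
  ... | yes w<n = subst VertexView (cong suc (Finₚ.toℕ-injective (trans (Finₚ.toℕ-inject₁ (fromℕ< w<n)) (Finₚ.toℕ-fromℕ< w<n)))) (at-inner (fromℕ< w<n))
  ... | no w≮n = subst VertexView (cong suc (Finₚ.toℕ-injective (trans (Finₚ.toℕ-fromℕ n) (sym w≡n)))) at-right
    where
    w≡n : toℕ w ≡ n
    w≡n = ℕₚ.≤-antisym (ℕₚ.≤-pred (Finₚ.toℕ<n w)) (ℕₚ.≮⇒≥ w≮n)

  module Transfer (ρ ρ' : Rotor) (M : ℕ → ℤ) (M0≡0 : M 0 ≡ 0ℤ) (Mn≡0 : M (suc n) ≡ 0ℤ) where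

    r : V₀ → ℤ
    r = routingVector ρ ρ' M

    Δ : Particle
    Δ = Δrouting ρ r

    routing-transfer : ∀ σ → routing r (ρ , σ) ≈C (ρ' , λ w → σ w + Δ w)
    routing-transfer σ = ≈C-trans (routing-formula r ρ σ)
      ((λ u → cong proj₂ (endLift-routingVector ρ ρ' M u)) , (λ w → refl))

    R L : ℕ → ℤ
    R i = rightFlow ρ ρ' M (suc i)
    L i = leftFlow ρ ρ' M (suc i)

    Δα : ∀ u → α (endLift ρ r u) - α (0ℤ , ρ u) ≡ R (toℕ u)
    Δα u rewrite endLift-routingVector ρ ρ' M u | arcIndex-toℕ ρ u | arcIndex-toℕ ρ' u =
      ring (M (suc (toℕ u))) (+ x) (+ (toℕ (ρ' u) ℕ.⊓ x)) (+ (toℕ (ρ u) ℕ.⊓ x))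
      where
      ring : ∀ m k a b → m * k + a - (0ℤ * k + b) ≡ k * m + a - b
      ring = solve-∀

    Δβ : ∀ u → β (endLift ρ r u) - β (0ℤ , ρ u) ≡ L (toℕ u)
    Δβ u rewrite endLift-routingVector ρ ρ' M u | arcIndex-toℕ ρ u | arcIndex-toℕ ρ' u =
      ring (M (suc (toℕ u))) (+ y) (+ (toℕ (ρ' u) ℕ.∸ x)) (+ (toℕ (ρ u) ℕ.∸ x))
      where
      ring : ∀ m k a b → m * k + a - (0ℤ * k + b) ≡ k * m + a - b
      ring = solve-∀

    ΔH : ∀ u → H (endLift ρ r u) - H (0ℤ , ρ u) ≡ R (toℕ u) + L (toℕ u)
    ΔH u = begin
      H e - H s                 ≡⟨ cong₂ _-_ (H≡α+β e) (H≡α+β s) ⟩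
      α e + β e - (α s + β s)   ≡⟨ ring (α e) (β e) (α s) (β s) ⟩
      (α e - α s) + (β e - β s) ≡⟨ cong₂ _+_ (Δα u) (Δβ u) ⟩
      R (toℕ u) + L (toℕ u)     ∎
      where
      open ≡-Reasoning
      e = endLift ρ r u
      s = (0ℤ , ρ u)
      ring : ∀ a b c d → a + b - (c + d) ≡ (a - c) + (b - d)
      ring = solve-∀

    Δ-select : ∀ w → Δ w ≡ select n R 2 (toℕ w) + select n L 0 (toℕ w) - select n (λ i → R i + L i) 1 (toℕ w)
    Δ-select w = begin
      Δ w                                  ≡⟨ ΣFin-- (λ u → dα u * δ (suc (suc u)) w + dβ u * δ (inject₁ (inject₁ u)) w) (λ u → dH u * δ (inner u) w) ⟩
      ΣFin (λ u → dα u * δ (suc (suc u)) w + dβ u * δ (inject₁ (inject₁ u)) w) - ΣFin (λ u → dH u * δ (inner u) w)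
                                           ≡⟨ cong (_- ΣFin (λ u → dH u * δ (inner u) w)) (ΣFin-+ (λ u → dα u * δ (suc (suc u)) w) (λ u → dβ u * δ (inject₁ (inject₁ u)) w)) ⟩
      ΣFin (λ u → dα u * δ (suc (suc u)) w) + ΣFin (λ u → dβ u * δ (inject₁ (inject₁ u)) w) - ΣFin (λ u → dH u * δ (inner u) w)
                                           ≡⟨ cong₂ _-_ (cong₂ _+_ (ΣFin-δ-select dα R (λ u → suc (suc u)) 2 Δα (λ u → refl) w)
                                                                   (ΣFin-δ-select dβ L (λ u → inject₁ (inject₁ u)) 0 Δβ toℕ-left w))
                                                        (ΣFin-δ-select dH (λ i → R i + L i) inner 1 ΔH toℕ-inner w) ⟩
      select n R 2 (toℕ w) + select n L 0 (toℕ w) - select n (λ i → R i + L i) 1 (toℕ w) ∎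
      where
      open ≡-Reasoning
      dα dβ dH : V₀ → ℤ
      dα u = α (endLift ρ r u) - α (0ℤ , ρ u)
      dβ u = β (endLift ρ r u) - β (0ℤ , ρ u)
      dH u = H (endLift ρ r u) - H (0ℤ , ρ u)

    net : ℕ → ℤ
    net = netFlow ρ ρ' M

    rightFlow-0 : rightFlow ρ ρ' M 0 ≡ 0ℤ
    rightFlow-0 = trans (cong (λ m → + x * m + 0ℤ - 0ℤ) M0≡0) (ring (+ x))
      where
      ring : ∀ k → k * 0ℤ + 0ℤ - 0ℤ ≡ 0ℤ
      ring = solve-∀

    leftFlow-sink : leftFlow ρ ρ' M (suc n) ≡ 0ℤ
    leftFlow-sink = begin
      + y * M (suc n) + leftPart ρ' (suc n) - leftPart ρ (suc n)  ≡⟨ cong₂ (λ m b → + y * m + b - leftPart ρ (suc n)) Mn≡0 (leftPart-sink ρ') ⟩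
      + y * 0ℤ + 0ℤ - leftPart ρ (suc n)                         ≡⟨ cong (λ b → + y * 0ℤ + 0ℤ - b) (leftPart-sink ρ) ⟩
      + y * 0ℤ + 0ℤ - 0ℤ                                         ≡⟨ ring (+ y) ⟩
      0ℤ                                                         ∎
      where
      open ≡-Reasoning
      ring : ∀ k → k * 0ℤ + 0ℤ - 0ℤ ≡ 0ℤ
      ring = solve-∀

    Δ-leftSink : Δ zero ≡ - net 0
    Δ-leftSink = begin
      Δ zero                                                       ≡⟨ Δ-select zero ⟩
      select n R 2 0 + select n L 0 0 - select n (λ i → R i + L i) 1 0
        ≡⟨ cong₂ (λ a c → a + select n L 0 0 - c) (select-below n R 2 0 (s≤s z≤n)) (select-below n (λ i → R i + L i) 1 0 (s≤s z≤n)) ⟩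
      0ℤ + select n L 0 0 - 0ℤ                                     ≡⟨ cong (λ b → 0ℤ + b - 0ℤ) (select-inside n L 0 0 z≤n (s≤s z≤n)) ⟩
      0ℤ + L 0 - 0ℤ                                                ≡⟨ ring (L 0) ⟩
      - (0ℤ - L 0)                                                 ≡⟨ cong (λ f → - (f - L 0)) (sym rightFlow-0) ⟩
      - net 0                                                      ∎
      where
      open ≡-Reasoning
      ring : ∀ b → 0ℤ + b - 0ℤ ≡ - (0ℤ - b)
      ring = solve-∀

    Δ-inner : ∀ u → Δ (inner u) ≡ net (toℕ u) - net (suc (toℕ u))
    Δ-inner u = begin
      Δ (inner u)
        ≡⟨ Δ-select (inner u) ⟩
      select n R 2 (toℕ (inner u)) + select n L 0 (toℕ (inner u)) - select n (λ i → R i + L i) 1 (toℕ (inner u))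
        ≡⟨ cong (λ t → select n R 2 t + select n L 0 t - select n (λ i → R i + L i) 1 t) (toℕ-inner u) ⟩
      select n R 2 (suc i) + select n L 0 (suc i) - select n (λ i → R i + L i) 1 (suc i)
        ≡⟨ cong₂ (λ a c → a + select n L 0 (suc i) - c) (right-in i i<n) (select-inside n (λ i → R i + L i) 1 (suc i) (s≤s z≤n) (s≤s i<n)) ⟩
      rightFlow ρ ρ' M i + select n L 0 (suc i) - (R i + L i)
        ≡⟨ cong (λ b → rightFlow ρ ρ' M i + b - (R i + L i)) (left-in i i<n) ⟩
      rightFlow ρ ρ' M i + L (suc i) - (R i + L i)
        ≡⟨ ring (rightFlow ρ ρ' M i) (L (suc i)) (R i) (L i) ⟩
      net i - net (suc i)
        ∎
      where
      open ≡-Reasoning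
      i = toℕ u
      i<n = Finₚ.toℕ<n u
      ring : ∀ a b c d → a + b - (c + d) ≡ (a - d) - (c - b)
      ring = solve-∀
      right-in : ∀ i → i < n → select n R 2 (suc i) ≡ rightFlow ρ ρ' M i
      right-in zero _ = trans (select-below n R 2 1 (ℕₚ.n<1+n 1)) (sym rightFlow-0)
      right-in (suc i) i<n = select-inside n R 2 (suc (suc i)) (s≤s (s≤s z≤n)) (s≤s (s≤s (ℕₚ.<⇒≤ i<n)))
      left-in : ∀ i → i < n → select n L 0 (suc i) ≡ L (suc i)
      left-in i i<n with ℕₚ.m≤n⇒m<n∨m≡n i<n
      ... | inj₁ 1+i<n = select-inside n L 0 (suc i) z≤n 1+i<n
      ... | inj₂ 1+i≡n = trans (select-above n L 0 (suc i) (ℕₚ.≤-reflexive (sym 1+i≡n)))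
                               (trans (sym leftFlow-sink) (cong (λ k → leftFlow ρ ρ' M (suc k)) (sym 1+i≡n)))

    Δ-rightSink : Δ rightSink ≡ net n
    Δ-rightSink = begin
      Δ rightSink
        ≡⟨ Δ-select rightSink ⟩
      select n R 2 (toℕ rightSink) + select n L 0 (toℕ rightSink) - select n (λ i → R i + L i) 1 (toℕ rightSink)
        ≡⟨ cong (λ t → select n R 2 t + select n L 0 t - select n (λ i → R i + L i) 1 t) (Finₚ.toℕ-fromℕ (suc n)) ⟩
      select n R 2 (suc n) + select n L 0 (suc n) - select n (λ i → R i + L i) 1 (suc n)
        ≡⟨ cong₂ (λ a b → a + b - select n (λ i → R i + L i) 1 (suc n))
                 (select-inside n R 2 (suc n) (s≤s (s≤s z≤n)) (ℕₚ.n<1+n (suc n))) (select-above n L 0 (suc n) (ℕₚ.n≤1+n n)) ⟩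
      R n₀ + 0ℤ - select n (λ i → R i + L i) 1 (suc n)
        ≡⟨ cong (λ c → R n₀ + 0ℤ - c) (select-above n (λ i → R i + L i) 1 (suc n) ℕₚ.≤-refl) ⟩
      R n₀ + 0ℤ - 0ℤ
        ≡⟨ ring (R n₀) ⟩
      R n₀ - 0ℤ
        ≡⟨ cong (_-_ (R n₀)) (sym leftFlow-sink) ⟩
      net n
        ∎
      where
      open ≡-Reasoning
      ring : ∀ a → a + 0ℤ - 0ℤ ≡ a - 0ℤ
      ring = solve-∀

    balanced⇒Δ≡0 : (∀ e → e ≤ n → net e ≡ 0ℤ) → ∀ w → Δ w ≡ 0ℤ
    balanced⇒Δ≡0 net≡0 w = go (vertexView w)
      where
      go : ∀ {w} → VertexView w → Δ w ≡ 0ℤ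
      go at-left = trans Δ-leftSink (cong -_ (net≡0 0 z≤n))
      go (at-inner u) = trans (Δ-inner u) (cong₂ _-_ (net≡0 (toℕ u) (ℕₚ.<⇒≤ (Finₚ.toℕ<n u))) (net≡0 (suc (toℕ u)) (Finₚ.toℕ<n u)))
      go at-right = trans Δ-rightSink (net≡0 n ℕₚ.≤-refl)

module Chain (n x y : ℕ) .{{_ : ℕ.NonZero y}} (x⊥y : Coprime x y) where

  weightℤ : ℕ → ℤ
  weightℤ i = + pathWeight n x y i

  Σweighted : (ℕ → ℤ) → ℕ → ℤ
  Σweighted e v = Σℤ v (λ u → weightℤ u * e u)

  -- scaled e v = y ^ v · M v for the rational solution M of x M v - y M (v + 1) = e v with M 0 = 0.
  scaled : (ℕ → ℤ) → ℕ → ℤ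
  scaled e zero = 0ℤ
  scaled e (suc v) = + x * scaled e v - + (y ℕ.^ v) * e v

  scaled-closed : ∀ e v → v ≤ suc n → + (x ℕ.^ (suc n ℕ.∸ v)) * scaled e v ≡ - Σweighted e v
  scaled-closed e zero _ = ℤₚ.*-zeroʳ (+ (x ℕ.^ suc n))
  scaled-closed e (suc v) v<1+n = begin
    P * (+ x * scaled e v - Y * e v)          ≡⟨ ring P (+ x) (scaled e v) Y (e v) ⟩
    (+ x * P) * scaled e v - P * Y * e v      ≡⟨ cong (λ t → t * scaled e v - P * Y * e v) xP≡ ⟩
    + (x ℕ.^ (suc n ℕ.∸ v)) * scaled e v - P * Y * e v ≡⟨ cong (λ t → t - P * Y * e v) (scaled-closed e v (ℕₚ.<⇒≤ v<1+n)) ⟩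
    - Σweighted e v - P * Y * e v             ≡⟨ cong (λ t → - Σweighted e v - t * e v) (sym (ℤₚ.pos-* (x ℕ.^ (n ℕ.∸ v)) (y ℕ.^ v))) ⟩
    - Σweighted e v - weightℤ v * e v         ≡⟨ sym (ℤₚ.neg-distrib-+ (Σweighted e v) (weightℤ v * e v)) ⟩
    - Σweighted e (suc v)                     ∎
    where
    open ≡-Reasoning
    P Y : ℤ
    P = + (x ℕ.^ (n ℕ.∸ v))
    Y = + (y ℕ.^ v)
    xP≡ : + x * P ≡ + (x ℕ.^ (suc n ℕ.∸ v))
    xP≡ = trans (sym (ℤₚ.pos-* x (x ℕ.^ (n ℕ.∸ v)))) (cong (λ k → + (x ℕ.^ k)) (sym (ℕₚ.+-∸-assoc 1 (ℕₚ.≤-pred v<1+n))))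
    ring : ∀ p x s y e → p * (x * s - y * e) ≡ (x * p) * s - p * y * e
    ring = solve-∀

  y^v∣tail : ∀ e v k → + (y ℕ.^ v) ℤ.∣ (Σweighted e (v ℕ.+ k) - Σweighted e v)
  y^v∣tail e v zero = subst (λ t → + (y ℕ.^ v) ℤ.∣ (Σweighted e t - Σweighted e v)) (sym (ℕₚ.+-identityʳ v))
                        (ℤ.divides 0ℤ (ℤₚ.+-inverseʳ (Σweighted e v)))
  y^v∣tail e v (suc k) = subst (λ t → + (y ℕ.^ v) ℤ.∣ (Σweighted e t - Σweighted e v)) (sym (ℕₚ.+-suc v k))
    (subst (+ (y ℕ.^ v) ℤ.∣_) (ring (Σweighted e (v ℕ.+ k)) (Σweighted e v) (weightℤ (v ℕ.+ k) * e (v ℕ.+ k)))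
      (ℤ.∣m∣n⇒∣m+n (y^v∣tail e v k) y^v∣term))
    where
    ring : ∀ a b c → a - b + c ≡ a + c - b
    ring = solve-∀
    y^v∣weight : + (y ℕ.^ v) ℤ.∣ weightℤ (v ℕ.+ k)
    y^v∣weight = subst (+ (y ℕ.^ v) ℤ.∣_) (sym (ℤₚ.pos-* (x ℕ.^ (n ℕ.∸ (v ℕ.+ k))) (y ℕ.^ (v ℕ.+ k))))
      (ℤ.∣n⇒∣m*n (+ (x ℕ.^ (n ℕ.∸ (v ℕ.+ k))))
        (subst (+ (y ℕ.^ v) ℤ.∣_) (trans (sym (ℤₚ.pos-* (y ℕ.^ v) (y ℕ.^ k))) (cong +_ (sym (ℕₚ.^-distribˡ-+-* y v k))))
          (ℤ.∣m⇒∣m*n (+ (y ℕ.^ k)) ℤ.∣-refl)))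
    y^v∣term : + (y ℕ.^ v) ℤ.∣ (weightℤ (v ℕ.+ k) * e (v ℕ.+ k))
    y^v∣term = ℤ.∣m⇒∣m*n (e (v ℕ.+ k)) y^v∣weight

  module _ (e : ℕ → ℤ) (total≡0 : Σweighted e (suc n) ≡ 0ℤ) where

    -- x ^ (n + 1 - v) · scaled e v is the tail Σ_{u ≥ v} weight u · e u, a multiple of y ^ v.
    y^v∣scaled : ∀ v → v ≤ suc n → + (y ℕ.^ v) ℤ.∣ scaled e v
    y^v∣scaled v v≤1+n = ℤ.∣ᵤ⇒∣ (ℤ.coprime-divisor (+ (y ℕ.^ v)) (+ (x ℕ.^ (suc n ℕ.∸ v))) (scaled e v)
                            (coprime-^-^ v (suc n ℕ.∸ v) (ℕ.sym x⊥y)) (ℤ.∣⇒∣ᵤ (subst (+ (y ℕ.^ v) ℤ.∣_) (sym eq) tail)))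
      where
      tail : + (y ℕ.^ v) ℤ.∣ (Σweighted e (suc n) - Σweighted e v)
      tail = subst (λ t → + (y ℕ.^ v) ℤ.∣ (Σweighted e t - Σweighted e v)) (ℕₚ.m+[n∸m]≡n v≤1+n) (y^v∣tail e v (suc n ℕ.∸ v))
      eq : + (x ℕ.^ (suc n ℕ.∸ v)) * scaled e v ≡ Σweighted e (suc n) - Σweighted e v
      eq = trans (scaled-closed e v v≤1+n) (trans (sym (ℤₚ.+-identityˡ (- Σweighted e v))) (cong (_- Σweighted e v) (sym total≡0)))

    solution : ℕ → ℤ
    solution v with v ℕ.≤? suc n
    ... | yes v≤1+n = ℤ.quotient (y^v∣scaled v v≤1+n)
    ... | no _ = 0ℤ

    scaled≡ : ∀ v → v ≤ suc n → scaled e v ≡ solution v * + (y ℕ.^ v)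
    scaled≡ v v≤1+n with v ℕ.≤? suc n
    ... | yes v≤1+n' = ℤ._∣_.equality (y^v∣scaled v v≤1+n')
    ... | no v≰1+n = ⊥-elim (v≰1+n v≤1+n)

    solution-0 : solution 0 ≡ 0ℤ
    solution-0 = trans (sym (ℤₚ.*-identityʳ (solution 0))) (sym (scaled≡ 0 z≤n))

    solution-end : solution (suc n) ≡ 0ℤ
    solution-end = ℤₚ.*-cancelʳ-≡ (solution (suc n)) 0ℤ (+ (y ℕ.^ suc n)) {{ℕₚ.m^n≢0 y (suc n)}}
      (trans (sym (scaled≡ (suc n) ℕₚ.≤-refl)) (trans scaled-end (sym (ℤₚ.*-zeroˡ (+ (y ℕ.^ suc n))))))
      where
      scaled-end : scaled e (suc n) ≡ 0ℤ
      scaled-end = begin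
        scaled e (suc n)                                    ≡⟨ ℤₚ.*-identityˡ (scaled e (suc n)) ⟨
        1ℤ * scaled e (suc n)                               ≡⟨ cong (λ k → + (x ℕ.^ k) * scaled e (suc n)) (ℕₚ.n∸n≡0 (suc n)) ⟨
        + (x ℕ.^ (suc n ℕ.∸ suc n)) * scaled e (suc n)      ≡⟨ scaled-closed e (suc n) ℕₚ.≤-refl ⟩
        - Σweighted e (suc n)                               ≡⟨ cong -_ total≡0 ⟩
        0ℤ                                                  ∎
        where open ≡-Reasoning

    solution-chain : ∀ v → v ≤ n → + x * solution v - + y * solution (suc v) ≡ e v
    solution-chain v v≤n = ℤₚ.*-cancelʳ-≡ _ _ Y {{ℕₚ.m^n≢0 y v}} (begin
      (+ x * solution v - + y * solution (suc v)) * Y               ≡⟨ ring (+ x) (+ y) (solution v) (solution (suc v)) Y ⟩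
      + x * (solution v * Y) - solution (suc v) * (+ y * Y)        ≡⟨ cong₂ (λ p q → + x * p - solution (suc v) * q) (sym (scaled≡ v (ℕₚ.m≤n⇒m≤1+n v≤n))) (sym (ℤₚ.pos-* y (y ℕ.^ v))) ⟩
      + x * scaled e v - solution (suc v) * + (y ℕ.^ suc v)        ≡⟨ cong (λ t → + x * scaled e v - t) (sym (scaled≡ (suc v) (s≤s v≤n))) ⟩
      + x * scaled e v - (+ x * scaled e v - Y * e v)              ≡⟨ ring₂ (+ x * scaled e v) (Y * e v) ⟩
      Y * e v                                                      ≡⟨ ℤₚ.*-comm Y (e v) ⟩
      e v * Y                                                      ∎)
      where
      open ≡-Reasoning
      Y = + (y ℕ.^ v)
      ring : ∀ x y a b c → (x * a - y * b) * c ≡ x * (a * c) - b * (y * c)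
      ring = solve-∀
      ring₂ : ∀ a b → a - (a - b) ≡ b
      ring₂ = solve-∀

module Classification (n₀ x₀ y₀ : ℕ) (x⊥y : Coprime (suc x₀) (suc y₀)) where

  open Routing n₀ x₀ y₀ public
  open Chain n x y x⊥y using (Σweighted; solution; solution-0; solution-end; solution-chain)

  -- F ≡ y ^ n modulo x and F ≡ x ^ n modulo y.
  coprime-x-F : Coprime x F
  coprime-x-F {d} (d∣x , d∣F) = coprime-^ n x⊥y (d∣x , subst (d ℕ.∣_) weight-n d∣weight-n)
    where
    x∣weight : ∀ i → i < n → x ℕ.∣ weight i
    x∣weight i i<n rewrite ℕₚ.+-∸-assoc 1 i<n = ℕ.∣m⇒∣m*n (y ℕ.^ i) (ℕ.m∣m*n (x ℕ.^ (n ℕ.∸ suc i)))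
    d∣weight-n : d ℕ.∣ weight n
    d∣weight-n = ℕ.∣m+n∣m⇒∣n d∣F (ℕ.∣-trans d∣x (∣-Σ< n weight x∣weight))
    weight-n : weight n ≡ y ℕ.^ n
    weight-n rewrite ℕₚ.n∸n≡0 n = ℕₚ.*-identityˡ (y ℕ.^ n)

  coprime-y-F : Coprime y F
  coprime-y-F {d} (d∣y , d∣F) = coprime-^ n (ℕ.sym x⊥y) (d∣y , subst (d ℕ.∣_) (ℕₚ.*-identityʳ (x ℕ.^ n)) d∣weight-0)
    where
    y∣weight : ∀ i → i < n → y ℕ.∣ weight (suc i)
    y∣weight i _ = ℕ.∣n⇒∣m*n (x ℕ.^ (n ℕ.∸ suc i)) (ℕ.m∣m*n (y ℕ.^ i))
    d∣weight-0 : d ℕ.∣ weight 0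
    d∣weight-0 = ℕ.∣m+n∣m⇒∣n (subst (d ℕ.∣_) (trans (Σ<-suc n weight) (ℕₚ.+-comm (weight 0) _)) d∣F)
                             (ℕ.∣-trans d∣y (∣-Σ< n (weight ∘ suc) y∣weight))

  F>0 : 0 < F
  F>0 = subst (0 <_) (sym (Σ<-suc n weight))
          (ℕₚ.<-≤-trans (subst (0 <_) (sym (ℕₚ.*-identityʳ (x ℕ.^ n))) (ℕₚ.m^n>0 x n)) (ℕₚ.m≤m+n (weight 0) _))

  Σweight≡height : ∀ k → Σℤ k weightℤ ≡ height k
  Σweight≡height zero = refl
  Σweight≡height (suc k) = trans (cong (_+ weightℤ k) (Σweight≡height k)) (sym (height-suc k))

  slope : Rotor → ℕ → ℤ
  slope ρ e = rightPart ρ e - leftPart ρ (suc e)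

  netFlow-chain : ∀ ρ ρ' M e → netFlow ρ ρ' M e ≡ (+ x * M e - + y * M (suc e)) - (slope ρ e - slope ρ' e)
  netFlow-chain ρ ρ' M e = ring (+ x * M e) (+ y * M (suc e)) (rightPart ρ e) (rightPart ρ' e) (leftPart ρ (suc e)) (leftPart ρ' (suc e))
    where
    ring : ∀ a b r r' l l' → a + r' - r - (b + l' - l) ≡ (a - b) - ((r - l) - (r' - l'))
    ring = solve-∀

  netFlow-fixed : ∀ ρ M e → netFlow ρ ρ M e ≡ + x * M e - + y * M (suc e)
  netFlow-fixed ρ M e = trans (netFlow-chain ρ ρ M e)
    (trans (cong (λ t → + x * M e - + y * M (suc e) - t) (ℤₚ.+-inverseʳ (slope ρ e))) (ℤₚ.+-identityʳ _))

  Σ-by-parts : ∀ (w : ℕ → ℤ) k → Σℤ k (λ e → weightℤ e * Σℤ e w) ≡ height k * Σℤ k w - Σℤ k (λ i → w i * height (suc i))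
  Σ-by-parts w zero = sym (ℤₚ.+-identityʳ (0ℤ * 0ℤ))
  Σ-by-parts w (suc k) = begin
    Σℤ k (λ e → weightℤ e * Σℤ e w) + weightℤ k * Σℤ k w         ≡⟨ cong (_+ weightℤ k * Σℤ k w) (Σ-by-parts w k) ⟩
    height k * Σℤ k w - S + weightℤ k * Σℤ k w                   ≡⟨ ring (height k) (weightℤ k) (Σℤ k w) (w k) S ⟩
    (height k + weightℤ k) * (Σℤ k w + w k) - (S + w k * (height k + weightℤ k))
                                                                  ≡⟨ cong (λ t → t * (Σℤ k w + w k) - (S + w k * t)) (sym (height-suc k)) ⟩
    height (suc k) * Σℤ (suc k) w - Σℤ (suc k) (λ i → w i * height (suc i)) ∎
    where
    open ≡-Reasoning
    S = Σℤ k (λ i → w i * height (suc i))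
    ring : ∀ H W P w S → H * P - S + W * P ≡ (H + W) * (P + w) - (S + w * (H + W))
    ring = solve-∀

  Σweighted-affine : ∀ (C : ℤ) (P : ℕ → ℤ) k → Σℤ k (λ v → weightℤ v * (C - P v)) ≡ C * height k - Σℤ k (λ v → weightℤ v * P v)
  Σweighted-affine C P k = begin
    Σℤ k (λ v → weightℤ v * (C - P v))                                ≡⟨ Σℤ-cong k (λ v _ → ℤₚ.*-distribˡ-+ (weightℤ v) C (- P v)) ⟩
    Σℤ k (λ v → weightℤ v * C + weightℤ v * - P v)                    ≡⟨ Σℤ-+ k (λ v → weightℤ v * C) (λ v → weightℤ v * - P v) ⟩
    Σℤ k (λ v → weightℤ v * C) + Σℤ k (λ v → weightℤ v * - P v)       ≡⟨ cong₂ _+_ (Σℤ-cong k (λ v _ → ℤₚ.*-comm (weightℤ v) C)) (Σℤ-cong k (λ v _ → sym (ℤₚ.neg-distribʳ-* (weightℤ v) (P v)))) ⟩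
    Σℤ k (λ v → C * weightℤ v) + Σℤ k (λ v → - (weightℤ v * P v))     ≡⟨ cong₂ _+_ (trans (Σℤ-* k C weightℤ) (cong (C *_) (Σweight≡height k))) (Σℤ-neg k (λ v → weightℤ v * P v)) ⟩
    C * height k - Σℤ k (λ v → weightℤ v * P v)                       ∎
    where open ≡-Reasoning

  innerDiff : Particle → Particle → ℕ → ℤ
  innerDiff σ σ' i with i ℕ.<? n
  ... | yes i<n = σ (inner (fromℕ< i<n)) - σ' (inner (fromℕ< i<n))
  ... | no _ = 0ℤ

  innerDiff-toℕ : ∀ σ σ' u → innerDiff σ σ' (toℕ u) ≡ σ (inner u) - σ' (inner u)
  innerDiff-toℕ σ σ' u with toℕ u ℕ.<? n
  ... | yes lt = cong (λ v → σ (inner v) - σ' (inner v)) (Finₚ.fromℕ<-toℕ u lt)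
  ... | no ¬lt = ⊥-elim (¬lt (Finₚ.toℕ<n u))

  innerDiff-n : ∀ σ σ' → innerDiff σ σ' n ≡ 0ℤ
  innerDiff-n σ σ' with n ℕ.<? n
  ... | yes n<n = ⊥-elim (ℕₚ.<-irrefl refl n<n)
  ... | no _ = refl

  Σ-innerDiff : ∀ σ σ' → Σℤ (suc n) (λ i → innerDiff σ σ' i * height (suc i)) ≡ hInner σ - hInner σ'
  Σ-innerDiff σ σ' = begin
    Σℤ n f + innerDiff σ σ' n * height (suc n)   ≡⟨ cong (λ t → Σℤ n f + t * height (suc n)) (innerDiff-n σ σ') ⟩
    Σℤ n f + 0ℤ * height (suc n)                 ≡⟨ ℤₚ.+-identityʳ (Σℤ n f) ⟩
    Σℤ n f                                       ≡⟨ ΣFin-toℕ n f ⟨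
    ΣFin {n} (f ∘ toℕ)                           ≡⟨ ΣFin-cong (λ u → cong₂ _*_ (innerDiff-toℕ σ σ' u) (sym (hVertex-inner u))) ⟩
    ΣFin (λ u → (σ (inner u) - σ' (inner u)) * hVertex (inner u))
                                                 ≡⟨ ΣFin-cong (λ u → ring (σ (inner u)) (σ' (inner u)) (hVertex (inner u))) ⟩
    ΣFin (λ u → σ (inner u) * hVertex (inner u) - σ' (inner u) * hVertex (inner u))
                                                 ≡⟨ ΣFin-- (λ u → σ (inner u) * hVertex (inner u)) (λ u → σ' (inner u) * hVertex (inner u)) ⟩
    hInner σ - hInner σ'                         ∎
    where
    open ≡-Reasoning
    f : ℕ → ℤ
    f i = innerDiff σ σ' i * height (suc i)
    ring : ∀ a b c → (a - b) * c ≡ a * c - b * c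
    ring = solve-∀

  ρ₀ : Rotor
  ρ₀ _ = zero

  -- The net flows of a routing from σ to σ' on V₀: they must telescope to the differences on V₀, and
  -- the constant is fixed by h σ - h σ' = q·F so that the chain equations become solvable.
  sandpileTarget : Particle → Particle → ℤ → ℕ → ℤ
  sandpileTarget σ σ' q e = Σℤ (suc n) (innerDiff σ σ') - q + (σ rightSink - σ' rightSink) - Σℤ e (innerDiff σ σ')

  sandpileTarget-telescopes : ∀ σ σ' q u → sandpileTarget σ σ' q (toℕ u) - sandpileTarget σ σ' q (suc (toℕ u)) ≡ σ (inner u) - σ' (inner u)
  sandpileTarget-telescopes σ σ' q u = trans (ring C (Σℤ (toℕ u) (innerDiff σ σ')) (innerDiff σ σ' (toℕ u))) (innerDiff-toℕ σ σ' u)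
    where
    C = Σℤ (suc n) (innerDiff σ σ') - q + (σ rightSink - σ' rightSink)
    ring : ∀ c p w → c - p - (c - (p + w)) ≡ w
    ring = solve-∀

  Σweighted-sandpileTarget : ∀ σ σ' q → h σ - h σ' ≡ q * + F → Σweighted (sandpileTarget σ σ' q) (suc n) ≡ 0ℤ
  Σweighted-sandpileTarget σ σ' q h-diff = begin
    Σweighted (λ e → C - P e) (suc n)                              ≡⟨ Σweighted-affine C P (suc n) ⟩
    C * height (suc n) - Σℤ (suc n) (λ v → weightℤ v * P v)        ≡⟨ cong (λ t → C * height (suc n) - t) (Σ-by-parts w (suc n)) ⟩
    C * height (suc n) - (height (suc n) * P (suc n) - Σℤ (suc n) (λ i → w i * height (suc i)))
                                                                   ≡⟨ cong (λ t → C * height (suc n) - (height (suc n) * P (suc n) - t)) (trans (Σ-innerDiff σ σ') hInner-diff) ⟩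
    C * height (suc n) - (height (suc n) * P (suc n) - (q - d) * height (suc n))
                                                                   ≡⟨ ring (P (suc n)) q d (height (suc n)) ⟩
    0ℤ                                                             ∎
    where
    open ≡-Reasoning
    d = σ rightSink - σ' rightSink
    w = innerDiff σ σ'
    P : ℕ → ℤ
    P e = Σℤ e w
    C = P (suc n) - q + d
    ring : ∀ p q d H → (p - q + d) * H - (H * p - (q - d) * H) ≡ 0ℤ
    ring = solve-∀
    hInner-diff : hInner σ - hInner σ' ≡ (q - d) * + F
    hInner-diff = begin
      hInner σ - hInner σ'                                                        ≡⟨ ring₁ (hInner σ) (hInner σ') (σ rightSink) (σ' rightSink) (+ F) ⟩
      (hInner σ + σ rightSink * + F) - (hInner σ' + σ' rightSink * + F) - d * + F ≡⟨ cong (_- d * + F) (sym (cong₂ _-_ (h-split σ) (h-split σ'))) ⟩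
      h σ - h σ' - d * + F                                                        ≡⟨ cong (_- d * + F) h-diff ⟩
      q * + F - d * + F                                                           ≡⟨ ring₂ q d (+ F) ⟩
      (q - d) * + F                                                               ∎
      where
      ring₁ : ∀ A B a b f → A - B ≡ (A + a * f) - (B + b * f) - (a - b) * f
      ring₁ = solve-∀
      ring₂ : ∀ a b c → a * c - b * c ≡ (a - b) * c
      ring₂ = solve-∀

  h≋⇒~S : ∀ (σ σ' : Particle) → h σ ≋ h σ' [mod F ] → σ ~S σ'
  h≋⇒~S σ σ' h≋ = σ₁ , (ρ₀ , T.r , ≈C-trans (T.routing-transfer σ₁) ((λ _ → refl) , (λ w → ring (σ w) (T.Δ w)))) , agree
    where
    q = proj₁ (≋-quotient (h σ) (h σ') h≋)
    target = sandpileTarget σ σ' q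
    total = Σweighted-sandpileTarget σ σ' q (proj₂ (≋-quotient (h σ) (h σ') h≋))
    module T = Transfer ρ₀ ρ₀ (solution target total) (solution-0 target total) (solution-end target total)
    σ₁ : Particle
    σ₁ v = σ v - T.Δ v
    ring : ∀ a b → a - b + b ≡ a
    ring = solve-∀
    net≡target : ∀ e → e ≤ n → T.net e ≡ target e
    net≡target e e≤n = trans (netFlow-fixed ρ₀ (solution target total) e) (solution-chain target total e e≤n)
    agree : ∀ u → σ₁ (inner u) ≡ σ' (inner u)
    agree u = begin
      σ (inner u) - T.Δ (inner u)                                   ≡⟨ cong (_-_ (σ (inner u))) (T.Δ-inner u) ⟩
      σ (inner u) - (T.net (toℕ u) - T.net (suc (toℕ u)))          ≡⟨ cong (_-_ (σ (inner u))) (cong₂ _-_ (net≡target (toℕ u) (ℕₚ.<⇒≤ (Finₚ.toℕ<n u)))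
                                                                                                      (net≡target (suc (toℕ u)) (Finₚ.toℕ<n u))) ⟩
      σ (inner u) - (target (toℕ u) - target (suc (toℕ u)))         ≡⟨ cong (_-_ (σ (inner u))) (sandpileTarget-telescopes σ σ' q u) ⟩
      σ (inner u) - (σ (inner u) - σ' (inner u))                    ≡⟨ ring₂ (σ (inner u)) (σ' (inner u)) ⟩
      σ' (inner u)                                                  ∎
      where
      open ≡-Reasoning
      ring₂ : ∀ a b → a - (a - b) ≡ b
      ring₂ = solve-∀

  g-formula : ∀ ρ → g ρ ≡ Σℤ (suc n) (λ e → weightℤ e * slope ρ e)
  g-formula ρ = begin
    g ρ                                                     ≡⟨ ΣFin-cong (λ u → trans (gArcℕ-closed u (toℕ (ρ u)))
                                                                (cong (λ t → weightℤ (suc (toℕ u)) * + (t ℕ.⊓ x) - weightℤ (toℕ u) * + (t ℕ.∸ x)) (sym (arcIndex-toℕ ρ u)))) ⟩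
    ΣFin {n} (f ∘ toℕ)                                      ≡⟨ ΣFin-toℕ n f ⟩
    Σℤ n f                                                  ≡⟨ Σℤ-- n (λ i → weightℤ (suc i) * A (suc i)) (λ i → weightℤ i * B (suc i)) ⟩
    Σℤ n (λ i → weightℤ (suc i) * A (suc i)) - Σℤ n (λ i → weightℤ i * B (suc i))
                                                            ≡⟨ cong₂ _-_ (sym first) (sym second) ⟩
    Σℤ (suc n) (λ e → weightℤ e * A e) - Σℤ (suc n) (λ e → weightℤ e * B (suc e))
                                                            ≡⟨ Σℤ-- (suc n) (λ e → weightℤ e * A e) (λ e → weightℤ e * B (suc e)) ⟨
    Σℤ (suc n) (λ e → weightℤ e * A e - weightℤ e * B (suc e)) ≡⟨ Σℤ-cong (suc n) (λ e _ → sym (ring (weightℤ e) (A e) (B (suc e)))) ⟩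
    Σℤ (suc n) (λ e → weightℤ e * slope ρ e)                ∎
    where
    open ≡-Reasoning
    A B : ℕ → ℤ
    A = rightPart ρ
    B = leftPart ρ
    f : ℕ → ℤ
    f i = weightℤ (suc i) * A (suc i) - weightℤ i * B (suc i)
    ring : ∀ a b c → a * (b - c) ≡ a * b - a * c
    ring = solve-∀
    first : Σℤ (suc n) (λ e → weightℤ e * A e) ≡ Σℤ n (λ i → weightℤ (suc i) * A (suc i))
    first = trans (Σℤ-suc n (λ e → weightℤ e * A e))
                  (trans (cong (_+ Σℤ n (λ i → weightℤ (suc i) * A (suc i))) (ℤₚ.*-zeroʳ (weightℤ 0))) (ℤₚ.+-identityˡ _))
    second : Σℤ (suc n) (λ e → weightℤ e * B (suc e)) ≡ Σℤ n (λ i → weightℤ i * B (suc i))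
    second = trans (cong (λ t → Σℤ n (λ i → weightℤ i * B (suc i)) + weightℤ n * t) (leftPart-sink ρ))
                   (trans (cong (_+_ (Σℤ n (λ i → weightℤ i * B (suc i)))) (ℤₚ.*-zeroʳ (weightℤ n))) (ℤₚ.+-identityʳ _))

  -- A lifted position (q , j') compared with the start (0 , j): a gain on the left forces q ≥ 0,
  -- and for q = 0 it forces j < j'; either way the right count does not drop.
  left-gain⇒right-gain : ∀ (q : ℤ) (j j' : ℕ) → j' < deg →
                         + (j ℕ.∸ x) ℤ.< + y * q + + (j' ℕ.∸ x) → + (j ℕ.⊓ x) ℤ.≤ + x * q + + (j' ℕ.⊓ x)
  left-gain⇒right-gain (+ zero) j j' _ gain rewrite pos-form y 0 (j' ℕ.∸ x) | pos-form x 0 (j' ℕ.⊓ x) | ℕₚ.*-zeroʳ y | ℕₚ.*-zeroʳ x =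
    ℤ.+≤+ (ℕₚ.⊓-monoˡ-≤ x (ℕₚ.<⇒≤ j<j'))
    where
    j<j' : j < j'
    j<j' = ℕₚ.≰⇒> (λ j'≤j → ℕₚ.<⇒≱ (ℤₚ.drop‿+<+ gain) (ℕₚ.∸-monoˡ-≤ x j'≤j))
  left-gain⇒right-gain (+ suc k) j j' _ _ rewrite pos-form x (suc k) (j' ℕ.⊓ x) =
    ℤ.+≤+ (ℕₚ.≤-trans (ℕₚ.m⊓n≤n j x) (ℕₚ.≤-trans (ℕₚ.m≤m*n x (suc k)) (ℕₚ.m≤m+n (x ℕ.* suc k) (j' ℕ.⊓ x))))
  left-gain⇒right-gain -[1+ k ] j j' j'<deg gain = ⊥-elim (ℤₚ.<⇒≱ gain (ℤₚ.≤-trans nonpositive (ℤ.+≤+ z≤n)))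
    where
    j'∸x≤y*k : j' ℕ.∸ x ≤ y ℕ.* suc k
    j'∸x≤y*k = ℕₚ.≤-trans (ℕₚ.<⇒≤ (ℕₚ.m<n+o⇒m∸n<o j' x j'<deg)) (ℕₚ.m≤m*n y (suc k))
    nonpositive : + y * -[1+ k ] + + (j' ℕ.∸ x) ℤ.≤ 0ℤ
    nonpositive = subst (λ t → t + + (j' ℕ.∸ x) ℤ.≤ 0ℤ)
                        (trans (cong -_ (ℤₚ.pos-* y (suc k))) (ℤₚ.neg-distribʳ-* (+ y) (+ suc k)))
                        (-m+t≤0 (y ℕ.* suc k) (j' ℕ.∸ x) j'∸x≤y*k)

  netFlow-swap : ∀ ρ ρ' M e → netFlow ρ' ρ (λ v → - M v) e ≡ - netFlow ρ ρ' M e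
  netFlow-swap ρ ρ' M e =
    ring (+ x) (+ y) (M e) (M (suc e)) (rightPart ρ e) (rightPart ρ' e) (leftPart ρ (suc e)) (leftPart ρ' (suc e))
    where
    ring : ∀ x y m m' r r' l l' → x * - m + r - r' - (y * - m' + l - l') ≡ - (x * m + r' - r - (y * m' + l' - l))
    ring = solve-∀

  -- Under a negative flow, induction along the path keeps the left counts growing, up to the right
  -- sink where nothing moves.
  negative-netFlow-impossible : ∀ ρ ρ' M k → M 0 ≡ 0ℤ → M (suc n) ≡ 0ℤ →
                                ¬ (∀ e → e ≤ n → netFlow ρ ρ' M e ≡ -[1+ k ])
  negative-netFlow-impossible ρ ρ' M k M0≡0 Mn≡0 net≡ = ℤₚ.<-irrefl (sym T.leftFlow-sink) (left>0 n ℕₚ.≤-refl)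
    where
    module T = Transfer ρ ρ' M M0≡0 Mn≡0
    R L : ℕ → ℤ
    R = rightFlow ρ ρ' M
    L = leftFlow ρ ρ' M
    left≡ : ∀ e → e ≤ n → L (suc e) ≡ R e + + suc k
    left≡ e e≤n = trans (ring (R e) (L (suc e))) (cong (_-_ (R e)) (net≡ e e≤n))
      where
      ring : ∀ r l → l ≡ r - (r - l)
      ring = solve-∀
    right≥0 : ∀ e → e ≤ n → 0ℤ ℤ.≤ R e
    left>0 : ∀ e → e ≤ n → 0ℤ ℤ.< L (suc e)
    right≥0 zero _ = ℤₚ.≤-reflexive (sym T.rightFlow-0)
    right≥0 (suc e) e<n = ℤₚ.i≤j⇒0≤j-i (left-gain⇒right-gain (M (suc e)) (arcIndex ρ e) (arcIndex ρ' e) (arcIndex-<deg ρ' e)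
                                          (0<i-j⇒j<i _ _ (left>0 e (ℕₚ.<⇒≤ e<n))))
    left>0 e e≤n = subst (0ℤ ℤ.<_) (sym (left≡ e e≤n)) (ℤₚ.+-mono-≤-< (right≥0 e e≤n) (ℤ.+<+ (s≤s z≤n)))

  constant-netFlow⇒0 : ∀ ρ ρ' M c → M 0 ≡ 0ℤ → M (suc n) ≡ 0ℤ → (∀ e → e ≤ n → netFlow ρ ρ' M e ≡ c) → c ≡ 0ℤ
  constant-netFlow⇒0 ρ ρ' M (+ zero) _ _ _ = refl
  constant-netFlow⇒0 ρ ρ' M (+ suc k) M0≡0 Mn≡0 net≡ = ⊥-elim (negative-netFlow-impossible ρ' ρ (λ v → - M v) k
    (cong -_ M0≡0) (cong -_ Mn≡0) (λ e e≤n → trans (netFlow-swap ρ ρ' M e) (cong -_ (net≡ e e≤n))))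
  constant-netFlow⇒0 ρ ρ' M -[1+ k ] M0≡0 Mn≡0 net≡ = ⊥-elim (negative-netFlow-impossible ρ ρ' M k M0≡0 Mn≡0 net≡)

  Σweighted-slopes : ∀ ρ ρ' c → g ρ - g ρ' ≡ c * + F → Σweighted (λ e → slope ρ e - slope ρ' e - c) (suc n) ≡ 0ℤ
  Σweighted-slopes ρ ρ' c g-diff = begin
    Σℤ (suc n) (λ e → weightℤ e * (slope ρ e - slope ρ' e - c))
      ≡⟨ Σℤ-cong (suc n) (λ e _ → ring (weightℤ e) (slope ρ e) (slope ρ' e) c) ⟩
    Σℤ (suc n) (λ e → weightℤ e * slope ρ e - weightℤ e * slope ρ' e - c * weightℤ e)
      ≡⟨ Σℤ-- (suc n) (λ e → weightℤ e * slope ρ e - weightℤ e * slope ρ' e) (λ e → c * weightℤ e) ⟩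
    Σℤ (suc n) (λ e → weightℤ e * slope ρ e - weightℤ e * slope ρ' e) - Σℤ (suc n) (λ e → c * weightℤ e)
      ≡⟨ cong₂ _-_ (Σℤ-- (suc n) (λ e → weightℤ e * slope ρ e) (λ e → weightℤ e * slope ρ' e))
                   (trans (Σℤ-* (suc n) c weightℤ) (cong (c *_) (Σweight≡height (suc n)))) ⟩
    Σℤ (suc n) (λ e → weightℤ e * slope ρ e) - Σℤ (suc n) (λ e → weightℤ e * slope ρ' e) - c * + F
      ≡⟨ cong (_- c * + F) (cong₂ _-_ (sym (g-formula ρ)) (sym (g-formula ρ'))) ⟩
    g ρ - g ρ' - c * + F
      ≡⟨ cong (_- c * + F) g-diff ⟩
    c * + F - c * + F
      ≡⟨ ℤₚ.+-inverseʳ (c * + F) ⟩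
    0ℤ
      ∎
    where
    open ≡-Reasoning
    ring : ∀ w a b c → w * (a - b - c) ≡ w * a - w * b - c * w
    ring = solve-∀

  -- Solve the chain equations with slack c, where g ρ - g ρ' = c·F; the resulting routing pushes the
  -- constant flow -c, so c = 0 and the routing moves no particle at all.
  g≋⇒~R : ∀ (ρ ρ' : Rotor) → g ρ ≋ g ρ' [mod F ] → ρ ~R ρ'
  g≋⇒~R ρ ρ' g≋ = 0P , T.r , ≈C-trans (T.routing-transfer 0P) ((λ _ → refl) , (λ w → trans (ℤₚ.+-identityˡ (T.Δ w)) (T.balanced⇒Δ≡0 net≡0 w)))
    where
    c = proj₁ (≋-quotient (g ρ) (g ρ') g≋)
    target : ℕ → ℤ
    target e = slope ρ e - slope ρ' e - c
    total = Σweighted-slopes ρ ρ' c (proj₂ (≋-quotient (g ρ) (g ρ') g≋))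
    M = solution target total
    module T = Transfer ρ ρ' M (solution-0 target total) (solution-end target total)
    net≡-c : ∀ e → e ≤ n → T.net e ≡ - c
    net≡-c e e≤n = trans (netFlow-chain ρ ρ' M e)
      (trans (cong (λ t → t - (slope ρ e - slope ρ' e)) (solution-chain target total e e≤n)) (ring (slope ρ e - slope ρ' e) c))
      where
      ring : ∀ d c → d - c - d ≡ - c
      ring = solve-∀
    net≡0 : ∀ e → e ≤ n → T.net e ≡ 0ℤ
    net≡0 e e≤n = trans (net≡-c e e≤n) (constant-netFlow⇒0 ρ ρ' M (- c) (solution-0 target total) (solution-end target total) net≡-c)

  g-rotate-right : ∀ ρ u → toℕ (ρ u) < x → g (ρ [ u ≔ θ (ρ u) ]) ≡ g ρ + weightℤ (suc (toℕ u))
  g-rotate-right ρ u ρu<x = begin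
    g (ρ [ u ≔ θ (ρ u) ])                                         ≡⟨ g-≔ ρ u (θ (ρ u)) ⟩
    g ρ + (gArc u (θ (ρ u)) - gArc u (ρ u))                       ≡⟨ cong (λ t → g ρ + (t - gArc u (ρ u))) (gArc-θ u (ρ u)) ⟩
    g ρ + (gArc u (ρ u) + (hVertex (head u (ρ u)) - hVertex (inner u)) - gArc u (ρ u))
                                                                  ≡⟨ cong (_+_ (g ρ)) (ring (gArc u (ρ u)) _) ⟩
    g ρ + (hVertex (head u (ρ u)) - hVertex (inner u))            ≡⟨ cong (λ v → g ρ + (hVertex v - hVertex (inner u))) (headℕ-< u (toℕ (ρ u)) ρu<x) ⟩
    g ρ + (hVertex (suc (suc u)) - hVertex (inner u))             ≡⟨ cong (_+_ (g ρ)) (hVertex-right-inner u) ⟩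
    g ρ + weightℤ (suc (toℕ u))                                   ∎
    where
    open ≡-Reasoning
    ring : ∀ a d → a + d - a ≡ d
    ring = solve-∀

  g-rotate-left : ∀ ρ u → x ≤ toℕ (ρ u) → g (ρ [ u ≔ θ (ρ u) ]) ≡ g ρ - weightℤ (toℕ u)
  g-rotate-left ρ u x≤ρu = begin
    g (ρ [ u ≔ θ (ρ u) ])                                         ≡⟨ g-≔ ρ u (θ (ρ u)) ⟩
    g ρ + (gArc u (θ (ρ u)) - gArc u (ρ u))                       ≡⟨ cong (λ t → g ρ + (t - gArc u (ρ u))) (gArc-θ u (ρ u)) ⟩
    g ρ + (gArc u (ρ u) + (hVertex (head u (ρ u)) - hVertex (inner u)) - gArc u (ρ u))
                                                                  ≡⟨ cong (_+_ (g ρ)) (ring (gArc u (ρ u)) _) ⟩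
    g ρ + (hVertex (head u (ρ u)) - hVertex (inner u))            ≡⟨ cong (λ v → g ρ + (hVertex v - hVertex (inner u))) (headℕ-≥ u (toℕ (ρ u)) x≤ρu) ⟩
    g ρ + (hVertex (inject₁ (inject₁ u)) - hVertex (inner u))     ≡⟨ cong (_+_ (g ρ)) (hVertex-left-inner u) ⟩
    g ρ - weightℤ (toℕ u)                                         ∎
    where
    open ≡-Reasoning
    ring : ∀ a d → a + d - a ≡ d
    ring = solve-∀

  Unchanged-above : ℕ → Rotor → Rotor → Set
  Unchanged-above m ρ' ρ = ∀ w → m < toℕ w → ρ' w ≡ ρ w

  ≔-unchanged-above : ∀ m ρ u a → toℕ u ≡ m → Unchanged-above m (ρ [ u ≔ a ]) ρ
  ≔-unchanged-above m ρ u a u≡m w m<w = ≔-other ρ u a w (λ w≡u → ℕₚ.<-irrefl (trans (sym u≡m) (cong toℕ (sym w≡u))) m<w)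

  unchanged-trans : ∀ {m ρ₁ ρ₂ ρ₃} → Unchanged-above m ρ₁ ρ₂ → Unchanged-above m ρ₂ ρ₃ → Unchanged-above m ρ₁ ρ₃
  unchanged-trans p q w m<w = trans (p w m<w) (q w m<w)

  unchanged-weaken : ∀ {m m' ρ₁ ρ₂} → m' < m → Unchanged-above m' ρ₁ ρ₂ → Unchanged-above m ρ₁ ρ₂
  unchanged-weaken m'<m p w m<w = p w (ℕₚ.<-trans m'<m m<w)

  -- The effect on g of routing one chip from u_{m+1} until it leaves u_1, …, u_{m+1}:
  -- to the right (across u_{m+1} → u_{m+2}) or into the left sink.
  Exit : ℕ → Rotor → Rotor → Set
  Exit m ρ' ρ = (g ρ' ≡ g ρ + weightℤ (suc m)) ⊎ (g ρ' ≡ g ρ - height (suc m))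

  Walk : ℕ → Rotor → Set
  Walk m ρ = ∃ λ ρ' → Unchanged-above m ρ' ρ × Exit m ρ' ρ

  walk-transport : ∀ {m ρ ρ₂} → Unchanged-above m ρ₂ ρ → g ρ₂ ≡ g ρ → Walk m ρ₂ → Walk m ρ
  walk-transport {m} unchanged g₂≡g (ρ₃ , unchanged₃ , exit) =
    ρ₃ , unchanged-trans unchanged₃ unchanged ,
    Sum.map (λ e → trans e (cong (_+ weightℤ (suc m)) g₂≡g)) (λ e → trans e (cong (_- height (suc m)) g₂≡g)) exit

  exit-right : ∀ m ρ u → toℕ u ≡ m → toℕ (ρ u) < x → Walk m ρ
  exit-right m ρ u u≡m right =
    ρ [ u ≔ θ (ρ u) ] , ≔-unchanged-above m ρ u _ u≡m ,
    inj₁ (trans (g-rotate-right ρ u right) (cong (λ t → g ρ + weightℤ (suc t)) u≡m))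

  walk-bottom : ∀ ρ u → toℕ u ≡ 0 → Walk 0 ρ
  walk-bottom ρ u u≡0 with toℕ (ρ u) ℕ.<? x
  ... | yes right = exit-right 0 ρ u u≡0 right
  ... | no left = ρ [ u ≔ θ (ρ u) ] , ≔-unchanged-above 0 ρ u _ u≡0 ,
                  inj₂ (trans (g-rotate-left ρ u (ℕₚ.≮⇒≥ left)) (cong (λ t → g ρ - weightℤ t) u≡0))

  -- When u serves a left arc the chip walks below u and either falls into the sink or comes back to
  -- u with g unchanged; in the latter case u's rotor has advanced, which the fuel accounts for.
  walk-circulate : ∀ m u → toℕ u ≡ suc m → (∀ ρ → Walk m ρ) → ∀ fuel ρ → deg ≤ toℕ (ρ u) ℕ.+ fuel → Walk (suc m) ρ
  walk-circulate m u u≡1+m walk-below fuel ρ enough with toℕ (ρ u) ℕ.<? x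
  ... | yes right = exit-right (suc m) ρ u u≡1+m right
  ... | no left with walk-below (ρ [ u ≔ θ (ρ u) ])
  ...   | ρ₂ , unchanged₂ , inj₂ sunk = ρ₂ , unchanged , inj₂ (begin
    g ρ₂                                         ≡⟨ sunk ⟩
    g (ρ [ u ≔ θ (ρ u) ]) - height (suc m)       ≡⟨ cong (_- height (suc m)) g-left ⟩
    g ρ - weightℤ (suc m) - height (suc m)       ≡⟨ ring (g ρ) (weightℤ (suc m)) (height (suc m)) ⟩
    g ρ - (height (suc m) + weightℤ (suc m))     ≡⟨ cong (_-_ (g ρ)) (sym (height-suc (suc m))) ⟩
    g ρ - height (suc (suc m))                   ∎)
    where
    open ≡-Reasoning
    g-left = trans (g-rotate-left ρ u (ℕₚ.≮⇒≥ left)) (cong (λ t → g ρ - weightℤ t) u≡1+m)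
    unchanged = unchanged-trans (unchanged-weaken (ℕₚ.n<1+n m) unchanged₂) (≔-unchanged-above (suc m) ρ u _ u≡1+m)
    ring : ∀ G w h → G - w - h ≡ G - (h + w)
    ring = solve-∀
  ...   | ρ₂ , unchanged₂ , inj₁ returned = walk-transport unchanged g₂≡g (again fuel enough)
    where
    g-left = trans (g-rotate-left ρ u (ℕₚ.≮⇒≥ left)) (cong (λ t → g ρ - weightℤ t) u≡1+m)
    unchanged = unchanged-trans (unchanged-weaken (ℕₚ.n<1+n m) unchanged₂) (≔-unchanged-above (suc m) ρ u _ u≡1+m)
    g₂≡g : g ρ₂ ≡ g ρ
    g₂≡g = trans returned (trans (cong (_+ weightℤ (suc m)) g-left) (ring (g ρ) (weightℤ (suc m))))
      where
      ring : ∀ a b → a - b + b ≡ a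
      ring = solve-∀
    ρ₂u≡θρu : ρ₂ u ≡ θ (ρ u)
    ρ₂u≡θρu = trans (unchanged₂ u (subst (m <_) (sym u≡1+m) (ℕₚ.n<1+n m))) (≔-same ρ u (θ (ρ u)))
    again : ∀ fuel → deg ≤ toℕ (ρ u) ℕ.+ fuel → Walk (suc m) ρ₂
    again zero enough' = ⊥-elim (ℕₚ.<⇒≱ (Finₚ.toℕ<n (ρ u)) (subst (deg ≤_) (ℕₚ.+-identityʳ _) enough'))
    again (suc fuel) enough' with suc (toℕ (ρ u)) ℕ.<? deg
    ... | yes no-wrap = walk-circulate m u u≡1+m walk-below fuel ρ₂
          (subst (λ t → deg ≤ t ℕ.+ fuel) (sym (trans (cong toℕ ρ₂u≡θρu) (toℕ-θ-< (ρ u) no-wrap))) (subst (deg ≤_) (ℕₚ.+-suc (toℕ (ρ u)) fuel) enough'))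
    ... | no wrap = exit-right (suc m) ρ₂ u u≡1+m
          (subst (_< x) (sym (trans (cong toℕ ρ₂u≡θρu) (toℕ-θ-wrap (ρ u) (ℕₚ.≤-antisym (Finₚ.toℕ<n (ρ u)) (ℕₚ.≮⇒≥ wrap))))) (s≤s z≤n))

  chip-walk : ∀ m → m < n → ∀ ρ → Walk m ρ
  chip-walk zero 0<n ρ = walk-bottom ρ (fromℕ< 0<n) (Finₚ.toℕ-fromℕ< 0<n)
  chip-walk (suc m) 1+m<n ρ = walk-circulate m u (Finₚ.toℕ-fromℕ< 1+m<n) (chip-walk m (ℕₚ.<-trans (ℕₚ.n<1+n m) 1+m<n))
                                             deg ρ (ℕₚ.m≤n+m deg (toℕ (ρ u)))
    where
    u = fromℕ< 1+m<n

  weight-n : weightℤ n ≡ + (y ℕ.^ n)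
  weight-n = cong +_ (trans (cong (λ k → x ℕ.^ k ℕ.* y ℕ.^ n) (ℕₚ.n∸n≡0 n)) (ℕₚ.*-identityˡ (y ℕ.^ n)))

  height-n : height n ≡ + F - + (y ℕ.^ n)
  height-n = trans (sym (ring (height n) (weightℤ n))) (cong₂ _-_ (sym (height-suc n)) weight-n)
    where
    ring : ∀ a b → a + b - b ≡ a
    ring = solve-∀

  -- Each chip dropped on u_n changes g by y ^ n modulo F.
  g-multiples : ∀ k → ∃ λ ρ → ∃ λ q → g ρ ≡ + k * + (y ℕ.^ n) + q * + F
  g-multiples zero = ρ₀ , 0ℤ , trans (ΣFin-zero (λ u → gArc u (ρ₀ u)) (λ u → refl)) (sym (ring (+ (y ℕ.^ n)) (+ F)))
    where
    ring : ∀ a b → 0ℤ * a + 0ℤ * b ≡ 0ℤ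
    ring = solve-∀
  g-multiples (suc k) with g-multiples k
  ... | ρ , q , gρ≡ with chip-walk n₀ (ℕₚ.n<1+n n₀) ρ
  ...   | ρ' , _ , inj₁ right = ρ' , q , (begin
    g ρ'                                            ≡⟨ right ⟩
    g ρ + weightℤ n                                 ≡⟨ cong₂ _+_ gρ≡ weight-n ⟩
    + k * Y + q * + F + Y                           ≡⟨ ring (+ k) Y q (+ F) ⟩
    (+ k + 1ℤ) * Y + q * + F                        ≡⟨ cong (λ t → t * Y + q * + F) (sym (pos-suc k)) ⟩
    + suc k * Y + q * + F                           ∎)
    where
    open ≡-Reasoning
    Y = + (y ℕ.^ n)
    ring : ∀ k Y q F → k * Y + q * F + Y ≡ (k + 1ℤ) * Y + q * F
    ring = solve-∀
  ...   | ρ' , _ , inj₂ sunk = ρ' , q - 1ℤ , (begin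
    g ρ'                                            ≡⟨ sunk ⟩
    g ρ - height n                                  ≡⟨ cong₂ _-_ gρ≡ height-n ⟩
    + k * Y + q * + F - (+ F - Y)                   ≡⟨ ring (+ k) Y q (+ F) ⟩
    (+ k + 1ℤ) * Y + (q - 1ℤ) * + F                 ≡⟨ cong (λ t → t * Y + (q - 1ℤ) * + F) (sym (pos-suc k)) ⟩
    + suc k * Y + (q - 1ℤ) * + F                    ∎)
    where
    open ≡-Reasoning
    Y = + (y ℕ.^ n)
    ring : ∀ k Y q F → k * Y + q * F - (F - Y) ≡ (k + 1ℤ) * Y + (q - 1ℤ) * F
    ring = solve-∀

  yⁿ-bézout : ∃ λ a → ∃ λ b → a * + (y ℕ.^ n) + b * + F ≡ 1ℤ
  yⁿ-bézout = bézout (y ℕ.^ n) F (ℕ.sym (coprime-^ n (ℕ.sym coprime-y-F)))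

  g-surjective : ∀ (c : ℤ) → ∃ λ (ρ : Rotor) → g ρ ≋ c [mod F ]
  g-surjective c = ρ , ≋-intro (g ρ) c (q - d * Y - c * b) (begin
    g ρ - c                                                    ≡⟨ cong₂ _-_ gρ≡ (sym (trans (cong (c *_) (proj₂ (proj₂ yⁿ-bézout))) (ℤₚ.*-identityʳ c))) ⟩
    + k * Y + q * + F - c * (a * Y + b * + F)                  ≡⟨ cong (λ t → t * Y + q * + F - c * (a * Y + b * + F)) k≡ ⟩
    (c * a - d * + F) * Y + q * + F - c * (a * Y + b * + F)    ≡⟨ ring c a Y (+ F) d q b ⟩
    (q - d * Y - c * b) * + F                                  ∎)
    where
    open ≡-Reasoning
    instance _ = ℕ.>-nonZero F>0
    a = proj₁ yⁿ-bézout
    b = proj₁ (proj₂ yⁿ-bézout)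
    Y = + (y ℕ.^ n)
    d = (c * a) ℤ./ℕ F
    k = (c * a) ℤ.%ℕ F
    ρ = proj₁ (g-multiples k)
    q = proj₁ (proj₂ (g-multiples k))
    gρ≡ = proj₂ (proj₂ (g-multiples k))
    k≡ : + k ≡ c * a - d * + F
    k≡ = sym (trans (cong (_- d * + F) (ℤ.a≡a%ℕn+[a/ℕn]*n (c * a) F)) (ring₀ (+ k) (d * + F)))
      where
      ring₀ : ∀ a b → a + b - b ≡ a
      ring₀ = solve-∀
    ring : ∀ c a Y F d q b → (c * a - d * F) * Y + q * F - c * (a * Y + b * F) ≡ (q - d * Y - c * b) * F
    ring = solve-∀

  ≡⇒≋ : ∀ {a b} → a ≡ b → a ≋ b [mod F ]
  ≡⇒≋ {a} {b} a≡b = ≋-intro a b 0ℤ (trans (cong (_- b) a≡b) (trans (ℤₚ.+-inverseʳ b) (sym (ℤₚ.*-zeroˡ (+ F)))))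

  xⁿ-bézout : ∃ λ a → ∃ λ b → a * + (x ℕ.^ n) + b * + F ≡ 1ℤ
  xⁿ-bézout = bézout (x ℕ.^ n) F (ℕ.sym (coprime-^ n (ℕ.sym coprime-x-F)))

  -- h(u_1) = x ^ n and h(u_{n+1}) = F, so a Bézout combination of the two has height 1.
  γ : Particle
  γ = (proj₁ xⁿ-bézout ·P δ (inner zero)) +P (proj₁ (proj₂ xⁿ-bézout) ·P δ rightSink)

  h-γ : h γ ≡ 1ℤ
  h-γ = begin
    h ((a ·P δ (inner zero)) +P (b ·P δ rightSink))      ≡⟨ h-+ (a ·P δ (inner zero)) (b ·P δ rightSink) ⟩
    h (a ·P δ (inner zero)) + h (b ·P δ rightSink)       ≡⟨ cong₂ _+_ (h-·P a (δ (inner zero))) (h-·P b (δ rightSink)) ⟩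
    a * h (δ (inner zero)) + b * h (δ rightSink)         ≡⟨ cong₂ (λ s t → a * s + b * t) (trans (h-δ (inner zero)) (cong +_ (ℕₚ.*-identityʳ (x ℕ.^ n))))
                                                                                         (trans (h-δ rightSink) hVertex-rightSink) ⟩
    a * + (x ℕ.^ n) + b * + F                            ≡⟨ proj₂ (proj₂ xⁿ-bézout) ⟩
    1ℤ                                                   ∎
    where
    open ≡-Reasoning
    a = proj₁ xⁿ-bézout
    b = proj₁ (proj₂ xⁿ-bézout)

  h-·γ : ∀ k → h (k ·P γ) ≡ k
  h-·γ k = trans (h-·P k γ) (trans (cong (k *_) h-γ) (ℤₚ.*-identityʳ k))

  ~S-·γ : ∀ (σ : Particle) → σ ~S (h σ ·P γ)
  ~S-·γ σ = h≋⇒~S σ (h σ ·P γ) (≡⇒≋ (sym (h-·γ (h σ))))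

  ·γ~S0⇔F∣ : ∀ (k : ℤ) → ((k ·P γ) ~S 0P) ⇔ ((+ F) ∣ k)
  ·γ~S0⇔F∣ k = mk⇔ (λ k·γ~0 → subst (+ F ∣_) h-diff (~S⇒h≋ (k ·P γ) 0P k·γ~0))
                   (λ F∣k → h≋⇒~S (k ·P γ) 0P (subst (+ F ∣_) (sym h-diff) F∣k))
    where
    h-diff : h (k ·P γ) - h 0P ≡ k
    h-diff = trans (cong₂ _-_ (h-·γ k) h-0P) (ℤₚ.+-identityʳ k)

  h-surjective : ∀ (c : ℤ) → ∃ λ (σ : Particle) → h σ ≋ c [mod F ]
  h-surjective c = c ·P γ , ≡⇒≋ (h-·γ c)

theorem6 : (n x y : ℕ) → 1 ≤ n → 1 ≤ x → x < y → Coprime x y →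
  let open Path n x y in
  -- (i) SP is cyclic of order F
  (Σ[ γ ∈ Particle ]
      ((∀ (σ : Particle) → ∃ λ (k : ℤ) → σ ~S (k ·P γ))
      × (∀ (k : ℤ) → ((k ·P γ) ~S 0P) ⇔ ((+ F) ∣ k))))
  -- (ii) h̄ is a well-defined group isomorphism SP ≅ ℤ/Fℤ
  × ((∀ (σ σ' : Particle) → h (σ +P σ') ≡ h σ + h σ')
    × (∀ (σ σ' : Particle) → (σ ~S σ') ⇔ (h σ ≋ h σ' [mod F ]))
    × (∀ (c : ℤ) → ∃ λ (σ : Particle) → h σ ≋ c [mod F ]))
  -- (iii) ḡ is a well-defined bijection R/∼ → ℤ/Fℤ
  × ((∀ (ρ ρ' : Rotor) → (ρ ~R ρ') ⇔ (g ρ ≋ g ρ' [mod F ]))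
    × (∀ (c : ℤ) → ∃ λ (ρ : Rotor) → g ρ ≋ c [mod F ]))
  -- (iv) routing^∞ invariant
  × (∀ (ρ ρ' : Rotor) (σ σ' : Particle) → (ρ' , σ') ∈routing∞ (ρ , σ) →
      g ρ' ≋ g ρ - h σ [mod F ])
theorem6 zero x y () _ _ _
theorem6 (suc n₀) zero y _ () _ _
theorem6 (suc n₀) (suc x₀) zero _ _ () _
theorem6 (suc n₀) (suc x₀) (suc y₀) _ _ _ x⊥y =
  (γ , (λ σ → h σ , ~S-·γ σ) , ·γ~S0⇔F∣) ,
  (h-+ , (λ σ σ' → mk⇔ (~S⇒h≋ σ σ') (h≋⇒~S σ σ')) , h-surjective) ,
  ((λ ρ ρ' → mk⇔ (~R⇒g≋ ρ ρ') (g≋⇒~R ρ ρ')) , g-surjective) ,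
  routing∞-g
  where
  open Classification n₀ x₀ y₀ x⊥y
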